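{- Let $\mathcal{L}$ be a language extending the language of arithmetic by finitely many relation symbols and finitely many constants. If $\mathcal{M}\models\mathrm{PA}(\mathcal{L})$ is nonstandard and short recursively saturated, then $\mathcal{M}$ is not finitely generated.
   Context: $\mathrm{PA}(\mathcal{L})$ is the extension of Peano arithmetic in the language $\mathcal{L}$ containing the full induction scheme for all $\mathcal{L}$-formulas. A type $p(x,\bar a)$ over $\mathcal{M}$ is bounded if it contains $x<c$ for some $c\in M$; $\mathcal{M}$ is short recursively saturated if it realizes every recursive bounded type (with finitely many parameters) that is finitely satisfiable in $\mathcal{M}$. $\mathcal{M}$ is finitely generated if there is a finite tuple (equivalently a single element) $a$ such that every element of $M$ is first-order definable in $\mathcal{M}$ from $a$. -}

module Defs where

open import Data.Nat using (ℕ; zero; suc; _+_; _*_; _^_; _<_)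
open import Data.Fin using (Fin; toℕ) renaming (zero to fz; suc to fs)
open import Data.Vec using (Vec; []; _∷_)
open import Data.List using (List)
open import Data.List.Relation.Unary.All using (All)
open import Data.Product using (Σ; _×_; _,_; ∃)
open import Data.Sum using (_⊎_)
open import Data.Empty using (⊥)
open import Relation.Nullary using (¬_)
open import Relation.Binary.PropositionalEquality using (_≡_)

record Lang : Set where
  field
    nConst : ℕ
    nRel   : ℕ
    arity  : Fin nRel → ℕ
open Lang public

data Term (L : Lang) (n : ℕ) : Set where
  var   : Fin n → Term L n
  `0    : Term L n
  `1    : Term L n
  _`+_  : Term L n → Term L n → Term L n
  _`*_  : Term L n → Term L n → Term L n
  const : Fin (nConst L) → Term L n

data Formula (L : Lang) : ℕ → Set where
  _`=_  : ∀ {n} → Term L n → Term L n → Formula L n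
  _`<_  : ∀ {n} → Term L n → Term L n → Formula L n
  rel   : ∀ {n} (i : Fin (nRel L)) → Vec (Term L n) (arity L i) → Formula L n
  `⊥    : ∀ {n} → Formula L n
  _`∧_  : ∀ {n} → Formula L n → Formula L n → Formula L n
  _`∨_  : ∀ {n} → Formula L n → Formula L n → Formula L n
  _`⇒_  : ∀ {n} → Formula L n → Formula L n → Formula L n
  `∀    : ∀ {n} → Formula L (suc n) → Formula L n
  `∃    : ∀ {n} → Formula L (suc n) → Formula L n

`¬ : ∀ {L n} → Formula L n → Formula L n
`¬ φ = φ `⇒ `⊥

_`⇔_ : ∀ {L n} → Formula L n → Formula L n → Formula L n
φ `⇔ ψ = (φ `⇒ ψ) `∧ (ψ `⇒ φ)

liftRen : ∀ {m n} → (Fin m → Fin n) → Fin (suc m) → Fin (suc n)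
liftRen ρ fz     = fz
liftRen ρ (fs i) = fs (ρ i)

renT : ∀ {L m n} → (Fin m → Fin n) → Term L m → Term L n
renT ρ (var i)   = var (ρ i)
renT ρ `0        = `0
renT ρ `1        = `1
renT ρ (s `+ t)  = renT ρ s `+ renT ρ t
renT ρ (s `* t)  = renT ρ s `* renT ρ t
renT ρ (const c) = const c

renTs : ∀ {L m n k} → (Fin m → Fin n) → Vec (Term L m) k → Vec (Term L n) k
renTs ρ []       = []
renTs ρ (t ∷ ts) = renT ρ t ∷ renTs ρ ts

liftSub : ∀ {L m n} → (Fin m → Term L n) → Fin (suc m) → Term L (suc n)
liftSub σ fz     = var fz
liftSub σ (fs i) = renT fs (σ i)

subT : ∀ {L m n} → (Fin m → Term L n) → Term L m → Term L n
subT σ (var i)   = σ i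
subT σ `0        = `0
subT σ `1        = `1
subT σ (s `+ t)  = subT σ s `+ subT σ t
subT σ (s `* t)  = subT σ s `* subT σ t
subT σ (const c) = const c

subTs : ∀ {L m n k} → (Fin m → Term L n) → Vec (Term L m) k → Vec (Term L n) k
subTs σ []       = []
subTs σ (t ∷ ts) = subT σ t ∷ subTs σ ts

subF : ∀ {L m n} → (Fin m → Term L n) → Formula L m → Formula L n
subF σ (s `= t)   = subT σ s `= subT σ t
subF σ (s `< t)   = subT σ s `< subT σ t
subF σ (rel i ts) = rel i (subTs σ ts)
subF σ `⊥         = `⊥
subF σ (φ `∧ ψ)   = subF σ φ `∧ subF σ ψ
subF σ (φ `∨ ψ)   = subF σ φ `∨ subF σ ψ
subF σ (φ `⇒ ψ)   = subF σ φ `⇒ subF σ ψ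
subF σ (`∀ φ)     = `∀ (subF (liftSub σ) φ)
subF σ (`∃ φ)     = `∃ (subF (liftSub σ) φ)

closeAll : ∀ {L n} → Formula L n → Formula L 0
closeAll {n = zero}  φ = φ
closeAll {n = suc n} φ = closeAll (`∀ φ)

private
  v0 : ∀ {L n} → Term L (suc n)
  v0 = var fz
  v1 : ∀ {L n} → Term L (suc (suc n))
  v1 = var (fs fz)
  v2 : ∀ {L n} → Term L (suc (suc (suc n)))
  v2 = var (fs (fs fz))

-- φ(0, ȳ) and φ(x+1, ȳ) for φ(x, ȳ) with x = variable 0
sub0 : ∀ {L n} → Fin (suc n) → Term L n
sub0 fz     = `0
sub0 (fs i) = var i

subS : ∀ {L n} → Fin (suc n) → Term L (suc n)
subS fz     = var fz `+ `1
subS (fs i) = var (fs i)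

inductionAxiom : ∀ {L n} → Formula L (suc n) → Formula L 0
inductionAxiom φ =
  closeAll ((subF sub0 φ `∧ `∀ (φ `⇒ subF subS φ)) `⇒ `∀ φ)

data PA (L : Lang) : Formula L 0 → Set where
  ax-succ-inj : PA L (`∀ (`∀ (((v1 `+ `1) `= (v0 `+ `1)) `⇒ (v1 `= v0))))
  ax-succ-ne0 : PA L (`∀ (`¬ ((v0 `+ `1) `= `0)))
  ax-pred     : PA L (`∀ ((v0 `= `0) `∨ `∃ (v1 `= (v0 `+ `1))))
  ax-add0     : PA L (`∀ ((v0 `+ `0) `= v0))
  ax-addS     : PA L (`∀ (`∀ ((v1 `+ (v0 `+ `1)) `= ((v1 `+ v0) `+ `1))))
  ax-mul0     : PA L (`∀ ((v0 `* `0) `= `0))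
  ax-mulS     : PA L (`∀ (`∀ ((v1 `* (v0 `+ `1)) `= ((v1 `* v0) `+ v1))))
  ax-lt       : PA L (`∀ (`∀ ((v1 `< v0) `⇔ `∃ (((v2 `+ v0) `+ `1) `= v1))))
  ax-ind      : ∀ {n} (φ : Formula L (suc n)) → PA L (inductionAxiom φ)

record Structure (L : Lang) : Set₁ where
  field
    Carrier : Set
    zeroM   : Carrier
    oneM    : Carrier
    addM    : Carrier → Carrier → Carrier
    mulM    : Carrier → Carrier → Carrier
    ltM     : Carrier → Carrier → Set
    constM  : Fin (nConst L) → Carrier
    relM    : (i : Fin (nRel L)) → Vec Carrier (arity L i) → Set
open Structure public

extend : ∀ {A : Set} {n} → A → (Fin n → A) → Fin (suc n) → A
extend a ρ fz     = a
extend a ρ (fs i) = ρ i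

module _ {L : Lang} (M : Structure L) where

  evalT : ∀ {n} → (Fin n → Carrier M) → Term L n → Carrier M
  evalT ρ (var i)   = ρ i
  evalT ρ `0        = zeroM M
  evalT ρ `1        = oneM M
  evalT ρ (s `+ t)  = addM M (evalT ρ s) (evalT ρ t)
  evalT ρ (s `* t)  = mulM M (evalT ρ s) (evalT ρ t)
  evalT ρ (const c) = constM M c

  evalTs : ∀ {n k} → (Fin n → Carrier M) → Vec (Term L n) k → Vec (Carrier M) k
  evalTs ρ []       = []
  evalTs ρ (t ∷ ts) = evalT ρ t ∷ evalTs ρ ts

  Sat : ∀ {n} → Formula L n → (Fin n → Carrier M) → Set
  Sat (s `= t)   ρ = evalT ρ s ≡ evalT ρ t
  Sat (s `< t)   ρ = ltM M (evalT ρ s) (evalT ρ t)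
  Sat (rel i ts) ρ = relM M i (evalTs ρ ts)
  Sat `⊥         ρ = ⊥
  Sat (φ `∧ ψ)   ρ = Sat φ ρ × Sat ψ ρ
  Sat (φ `∨ ψ)   ρ = Sat φ ρ ⊎ Sat ψ ρ
  Sat (φ `⇒ ψ)   ρ = Sat φ ρ → Sat ψ ρ
  Sat (`∀ φ)     ρ = (d : Carrier M) → Sat φ (extend d ρ)
  Sat (`∃ φ)     ρ = Σ (Carrier M) λ d → Sat φ (extend d ρ)

  noVars : Fin 0 → Carrier M
  noVars ()

  ModelOfPA : Set
  ModelOfPA = (σ : Formula L 0) → PA L σ → Sat σ noVars

  numeral : ℕ → Carrier M
  numeral zero    = zeroM M
  numeral (suc n) = addM M (numeral n) (oneM M)

  Nonstandard : Set
  Nonstandard = Σ (Carrier M) λ c → (n : ℕ) → ¬ (c ≡ numeral n)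

data Code : ℕ → Set where
  zeroC : ∀ {n} → Code n
  succC : Code 1
  projC : ∀ {n} → Fin n → Code n
  compC : ∀ {m n} → Code m → Vec (Code n) m → Code n
  recC  : ∀ {n} → Code n → Code (suc (suc n)) → Code (suc n)
  muC   : ∀ {n} → Code (suc n) → Code n

data Eval : ∀ {n} → Code n → Vec ℕ n → ℕ → Set
data EvalVec : ∀ {m n} → Vec (Code n) m → Vec ℕ n → Vec ℕ m → Set

data Eval where
  ev-zero : ∀ {n} {xs : Vec ℕ n} → Eval zeroC xs 0
  ev-succ : ∀ {x} → Eval succC (x ∷ []) (suc x)
  ev-proj : ∀ {n} {xs : Vec ℕ n} (i : Fin n) → Eval (projC i) xs (Data.Vec.lookup xs i)
  ev-comp : ∀ {m n} {f : Code m} {gs : Vec (Code n) m} {xs ys y} →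
            EvalVec gs xs ys → Eval f ys y → Eval (compC f gs) xs y
  ev-rec0 : ∀ {n} {f : Code n} {g xs y} →
            Eval f xs y → Eval (recC f g) (0 ∷ xs) y
  ev-recS : ∀ {n} {f : Code n} {g xs k y z} →
            Eval (recC f g) (k ∷ xs) y → Eval g (k ∷ y ∷ xs) z →
            Eval (recC f g) (suc k ∷ xs) z
  ev-mu   : ∀ {n} {f : Code (suc n)} {xs y} →
            Eval f (y ∷ xs) 0 →
            ((z : ℕ) → z < y → Σ ℕ λ v → Eval f (z ∷ xs) (suc v)) →
            Eval (muC f) xs y

data EvalVec where
  evv-[] : ∀ {n} {xs : Vec ℕ n} → EvalVec [] xs []
  evv-∷  : ∀ {m n} {g : Code n} {gs : Vec (Code n) m} {xs y ys} →
           Eval g xs y → EvalVec gs xs ys → EvalVec (g ∷ gs) xs (y ∷ ys)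

-- A ⊆ ℕ is recursive: some μ-recursive function is total and computes
-- its characteristic function (0 = in A, 1 = not in A).
Recursive : (ℕ → Set) → Set
Recursive A = Σ (Code 1) λ f → (x : ℕ) →
  (A x × Eval f (x ∷ []) 0) ⊎ (¬ A x × Eval f (x ∷ []) 1)

pair : ℕ → ℕ → ℕ
pair a b = 2 ^ a * suc (2 * b)

codeT : ∀ {L n} → Term L n → ℕ
codeT (var i)   = pair 0 (toℕ i)
codeT `0        = pair 1 0
codeT `1        = pair 2 0
codeT (s `+ t)  = pair 3 (pair (codeT s) (codeT t))
codeT (s `* t)  = pair 4 (pair (codeT s) (codeT t))
codeT (const c) = pair 5 (toℕ c)

codeTs : ∀ {L n k} → Vec (Term L n) k → ℕ
codeTs []       = 0
codeTs (t ∷ ts) = suc (pair (codeT t) (codeTs ts))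

codeF : ∀ {L n} → Formula L n → ℕ
codeF (s `= t)   = pair 0 (pair (codeT s) (codeT t))
codeF (s `< t)   = pair 1 (pair (codeT s) (codeT t))
codeF (rel i ts) = pair 2 (pair (toℕ i) (codeTs ts))
codeF `⊥         = pair 3 0
codeF (φ `∧ ψ)   = pair 4 (pair (codeF φ) (codeF ψ))
codeF (φ `∨ ψ)   = pair 5 (pair (codeF φ) (codeF ψ))
codeF (φ `⇒ ψ)   = pair 6 (pair (codeF φ) (codeF ψ))
codeF (`∀ φ)     = pair 7 (codeF φ)
codeF (`∃ φ)     = pair 8 (codeF φ)

-- Types p(x, ȳ): sets of formulas in variables x (= var 0) and
-- ȳ (= var 1 … var m), to be evaluated at parameters ā ∈ M^m.

FormulaSet : Lang → ℕ → Set₁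
FormulaSet L m = Formula L (suc m) → Set

RecursiveType : ∀ {L m} → FormulaSet L m → Set
RecursiveType {L} {m} p =
  Recursive (λ k → Σ (Formula L (suc m)) λ φ → p φ × codeF φ ≡ k)

BoundedType : ∀ {L m} → FormulaSet L m → Set
BoundedType {m = m} p = Σ (Fin m) λ j → p (var fz `< var (fs j))

module _ {L : Lang} (M : Structure L) where

  Realizes : ∀ {m} → (Fin m → Carrier M) → Carrier M → List (Formula L (suc m)) → Set
  Realizes ā b φs = All (λ φ → Sat M φ (extend b ā)) φs

  FinitelySatisfiable : ∀ {m} → FormulaSet L m → (Fin m → Carrier M) → Set
  FinitelySatisfiable {m} p ā =
    (φs : List (Formula L (suc m))) → All p φs →
    Σ (Carrier M) λ b → Realizes ā b φs

  Realized : ∀ {m} → FormulaSet L m → (Fin m → Carrier M) → Set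
  Realized {m} p ā = Σ (Carrier M) λ b → (φ : Formula L (suc m)) → p φ → Sat M φ (extend b ā)

  ShortRecursivelySaturated : Set₁
  ShortRecursivelySaturated =
    (m : ℕ) (ā : Fin m → Carrier M) (p : FormulaSet L m) →
    RecursiveType p → BoundedType p → FinitelySatisfiable p ā → Realized p ā

  DefinableFrom : ∀ {m} → (Fin m → Carrier M) → Carrier M → Set
  DefinableFrom {m} ā b = Σ (Formula L (suc m)) λ φ →
    Sat M φ (extend b ā) × ((b' : Carrier M) → Sat M φ (extend b' ā) → b' ≡ b)

  FinitelyGenerated : Set
  FinitelyGenerated = Σ ℕ λ m → Σ (Fin m → Carrier M) λ ā →
    (b : Carrier M) → DefinableFrom ā b

{-# OPTIONS --safe #-}
-- Let c be nonstandard and ā a tuple of parameters.  The type in x over c, ā consisting of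
-- x < c and, for every formula χ(d, c, ā) not mentioning x, "x is not the unique d with
-- χ(d, c, ā)" is bounded and recursive: deciding membership of a code only requires
-- recognising codes of formulas in which a given variable does not occur, which a stack
-- machine does in as many steps as the code is large.  It is finitely satisfiable, since
-- each χ defines at most one element while the infinitely many numerals all lie below c.
-- A realisation is an element not definable from ā, so no finite tuple generates M.

module Submission where

open import Defs
open import Axiom.ExcludedMiddle using (ExcludedMiddle)
open import Level using (0ℓ)
open import Data.Nat using (ℕ; zero; suc; _+_; _*_; _∸_; _^_; _≤_; _<_; _⊓_; _⊔_; z≤n; s≤s; pred)
open import Data.Nat.Properties
open import Data.Nat.ListAction using (sum)
open import Data.Nat.ListAction.Properties using (sum-++)
open import Data.Fin using (Fin; toℕ; fromℕ<; #_) renaming (zero to fz; suc to fs)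
open import Data.Fin.Properties using (toℕ-fromℕ<; toℕ<n)
open import Data.Vec using (Vec; []; _∷_; lookup)
open import Data.List using (List; []; _∷_; _++_; map)
open import Data.List.Properties using (map-++)
open import Data.List.Relation.Unary.All as All using (All; []; _∷_)
open import Data.List.Relation.Unary.All.Properties using (++⁺; ++⁻)
open import Data.Unit using (⊤; tt)
open import Data.Product using (Σ; _×_; _,_; proj₁; proj₂)
open import Data.Product.Function.NonDependent.Propositional using (_×-⇔_)
open import Data.Product.Function.Dependent.Propositional using (Σ-⇔)
open import Data.Sum using (_⊎_; inj₁; inj₂)
open import Data.Sum.Function.Propositional using (_⊎-⇔_)
open import Function using (_∘_; _⇔_; mk⇔; Equivalence)
open import Function.Construct.Identity using (⇔-id; ↠-id)
open import Function.Related.TypeIsomorphisms using (→-cong-⇔)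
open import Relation.Nullary using (¬_; yes; no; contradiction)
open import Relation.Binary.PropositionalEquality

Computable : (n : ℕ) → (Vec ℕ n → ℕ) → Set
Computable n g = Σ (Code n) λ c → ∀ xs → Eval c xs (g xs)

Computable₁ : (ℕ → ℕ) → Set
Computable₁ f = Computable 1 λ { (x ∷ []) → f x }

Computable₂ : (ℕ → ℕ → ℕ) → Set
Computable₂ f = Computable 2 λ { (x ∷ y ∷ []) → f x y }

Computable₃ : (ℕ → ℕ → ℕ → ℕ) → Set
Computable₃ f = Computable 3 λ { (x ∷ y ∷ z ∷ []) → f x y z }

Computable₄ : (ℕ → ℕ → ℕ → ℕ → ℕ) → Set
Computable₄ f = Computable 4 λ { (x ∷ y ∷ z ∷ w ∷ []) → f x y z w }

data Expr (n : ℕ) : Set where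
  arg : Fin n → Expr n
  lit : ℕ → Expr n
  _·_ : ∀ {k g} → Computable k g → Vec (Expr n) k → Expr n

⟦_⟧ : ∀ {n} → Expr n → Vec ℕ n → ℕ
⟦_⟧ⱽ : ∀ {n k} → Vec (Expr n) k → Vec ℕ n → Vec ℕ k
⟦ arg i ⟧ xs = lookup xs i
⟦ lit k ⟧ xs = k
⟦ _·_ {g = g} _ es ⟧ xs = g (⟦ es ⟧ⱽ xs)
⟦ [] ⟧ⱽ xs = []
⟦ e ∷ es ⟧ⱽ xs = ⟦ e ⟧ xs ∷ ⟦ es ⟧ⱽ xs

literal : ∀ {n} k → Computable n λ _ → k
literal zero    = zeroC , λ _ → ev-zero
literal (suc k) = compC succC (proj₁ (literal k) ∷ []) ,
                  λ xs → ev-comp (evv-∷ (proj₂ (literal k) xs) evv-[]) ev-succ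

compile : ∀ {n} (e : Expr n) → Computable n ⟦ e ⟧
compileⱽ : ∀ {n k} (es : Vec (Expr n) k) →
           Σ (Vec (Code n) k) λ cs → ∀ xs → EvalVec cs xs (⟦ es ⟧ⱽ xs)
compile (arg i)        = projC i , λ _ → ev-proj i
compile (lit k)        = literal k
compile ((c , ev) · es) with compileⱽ es
... | cs , evs = compC c cs , λ xs → ev-comp (evs xs) (ev _)
compileⱽ []       = [] , λ _ → evv-[]
compileⱽ (e ∷ es) with compile e | compileⱽ es
... | c , ev | cs , evs = c ∷ cs , λ xs → evv-∷ (ev xs) (evs xs)

computable-by : ∀ {n g} (e : Expr n) → (∀ xs → ⟦ e ⟧ xs ≡ g xs) → Computable n g
computable-by e eq with compile e
... | c , ev = c , λ xs → subst (Eval c xs) (eq xs) (ev xs)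

computable-rec : ∀ {n} {h : Vec ℕ (suc n) → ℕ} (base : Expr n) (step : Expr (suc (suc n))) →
                 (∀ xs → h (0 ∷ xs) ≡ ⟦ base ⟧ xs) →
                 (∀ k xs → h (suc k ∷ xs) ≡ ⟦ step ⟧ (k ∷ h (k ∷ xs) ∷ xs)) →
                 Computable (suc n) h
computable-rec {h = h} base step eq₀ eqₛ with compile base | compile step
... | cb , evb | cs , evs = recC cb cs , go
  where
  go : ∀ xs → Eval (recC cb cs) xs (h xs)
  go (zero  ∷ xs) = subst (Eval _ _) (sym (eq₀ xs)) (ev-rec0 (evb xs))
  go (suc k ∷ xs) = subst (Eval _ _) (sym (eqₛ k xs)) (ev-recS (go (k ∷ xs)) (evs _))

suc-computable : Computable₁ suc
suc-computable = succC , λ { (x ∷ []) → ev-succ }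

+-computable : Computable₂ _+_
+-computable = computable-rec (arg (# 0)) (suc-computable · (arg (# 1) ∷ []))
  (λ { (y ∷ []) → refl }) (λ { k (y ∷ []) → refl })

*-computable : Computable₂ _*_
*-computable = computable-rec (lit 0) (+-computable · (arg (# 2) ∷ arg (# 1) ∷ []))
  (λ { (y ∷ []) → refl }) (λ { k (y ∷ []) → refl })

pred-computable : Computable₁ pred
pred-computable = computable-rec (lit 0) (arg (# 0)) (λ { [] → refl }) (λ { k [] → refl })

if0_then_else_ : ℕ → ℕ → ℕ → ℕ
if0 zero  then a else b = a
if0 suc _ then a else b = b

if0-computable : Computable₃ if0_then_else_
if0-computable = computable-rec (arg (# 0)) (arg (# 3))
  (λ { (a ∷ b ∷ []) → refl }) (λ { k (a ∷ b ∷ []) → refl })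

sg : ℕ → ℕ
sg zero    = 0
sg (suc _) = 1

sg-computable : Computable₁ sg
sg-computable = computable-rec (lit 0) (lit 1) (λ { [] → refl }) (λ { k [] → refl })

∸-computable : Computable₂ _∸_
∸-computable = computable-by (flipped · (arg (# 1) ∷ arg (# 0) ∷ [])) λ { (x ∷ y ∷ []) → refl }
  where
  flipped : Computable₂ λ y x → x ∸ y
  flipped = computable-rec (arg (# 0)) (pred-computable · (arg (# 1) ∷ []))
    (λ { (x ∷ []) → refl }) (λ { k (x ∷ []) → sym (pred[m∸n]≡m∸[1+n] x k) })

-- Truth values are Kleene's: 0 means true, as in the definition of Recursive.
eqℕ : ℕ → ℕ → ℕ
eqℕ x y = sg ((x ∸ y) + (y ∸ x))

ltℕ : ℕ → ℕ → ℕ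
ltℕ x y = sg (suc x ∸ y)

eqℕ-computable : Computable₂ eqℕ
eqℕ-computable = computable-by
  (sg-computable · (+-computable · (∸-computable · (arg (# 0) ∷ arg (# 1) ∷ [])
                                  ∷ ∸-computable · (arg (# 1) ∷ arg (# 0) ∷ []) ∷ []) ∷ []))
  λ { (x ∷ y ∷ []) → refl }

ltℕ-computable : Computable₂ ltℕ
ltℕ-computable = computable-by
  (sg-computable · (∸-computable · (suc-computable · (arg (# 0) ∷ []) ∷ arg (# 1) ∷ []) ∷ []))
  λ { (x ∷ y ∷ []) → refl }

infix 0 if0ᵉ_then_else_
if0ᵉ_then_else_ : ∀ {n} → Expr n → Expr n → Expr n → Expr n
if0ᵉ c then a else b = if0-computable · (c ∷ a ∷ b ∷ [])

eqᵉ ltᵉ : ∀ {n} → Expr n → Expr n → Expr n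
eqᵉ a b = eqℕ-computable · (a ∷ b ∷ [])
ltᵉ a b = ltℕ-computable · (a ∷ b ∷ [])

sucᵉ predᵉ : ∀ {n} → Expr n → Expr n
sucᵉ a = suc-computable · (a ∷ [])
predᵉ a = pred-computable · (a ∷ [])

2^-computable : Computable₁ (2 ^_)
2^-computable = computable-rec (lit 1) (*-computable · (lit 2 ∷ arg (# 1) ∷ []))
  (λ { [] → refl }) (λ { k [] → refl })

pair-computable : Computable₂ pair
pair-computable = computable-by
  (*-computable · (2^-computable · (arg (# 0) ∷ [])
                 ∷ suc-computable · (*-computable · (lit 2 ∷ arg (# 1) ∷ []) ∷ []) ∷ []))
  λ { (a ∷ b ∷ []) → refl }

sg≡0⇒≡0 : ∀ {n} → sg n ≡ 0 → n ≡ 0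
sg≡0⇒≡0 {zero} _ = refl

eqℕ≡0⇒≡ : ∀ {x y} → eqℕ x y ≡ 0 → x ≡ y
eqℕ≡0⇒≡ {x} {y} eq =
  ≤-antisym (m∸n≡0⇒m≤n (m+n≡0⇒m≡0 (x ∸ y) d≡0)) (m∸n≡0⇒m≤n (m+n≡0⇒n≡0 (x ∸ y) d≡0))
  where
  d≡0 : (x ∸ y) + (y ∸ x) ≡ 0
  d≡0 = sg≡0⇒≡0 eq

eqℕ-refl : ∀ x → eqℕ x x ≡ 0
eqℕ-refl x rewrite n∸n≡0 x = refl

≡⇒eqℕ≡0 : ∀ {x y} → x ≡ y → eqℕ x y ≡ 0
≡⇒eqℕ≡0 {x} refl = eqℕ-refl x

eqℕ-≢ : ∀ {x y} → x ≢ y → eqℕ x y ≡ 1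
eqℕ-≢ {x} {y} x≢y with (x ∸ y) + (y ∸ x) in eq
... | zero  = contradiction (eqℕ≡0⇒≡ (cong sg eq)) x≢y
... | suc _ = refl

ltℕ≡0⇒< : ∀ {x y} → ltℕ x y ≡ 0 → x < y
ltℕ≡0⇒< eq = m∸n≡0⇒m≤n (sg≡0⇒≡0 eq)

<⇒ltℕ≡0 : ∀ {x y} → x < y → ltℕ x y ≡ 0
<⇒ltℕ≡0 x<y = cong sg (m≤n⇒m∸n≡0 x<y)

recursive-by-zeros : ∀ {A : ℕ → Set} {g : ℕ → ℕ} → Computable₁ g →
                     (∀ x → g x ≡ 0 → A x) → (∀ x → A x → g x ≡ 0) → Recursive A
recursive-by-zeros {A} {g} g-computable sound complete = proj₁ sg∘g-computable , decide
  where
  sg∘g-computable : Computable₁ (sg ∘ g)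
  sg∘g-computable = computable-by (sg-computable · (g-computable · (arg (# 0) ∷ []) ∷ [])) λ { (x ∷ []) → refl }
  evaluates : ∀ x → Eval (proj₁ sg∘g-computable) (x ∷ []) (sg (g x))
  evaluates x = proj₂ sg∘g-computable (x ∷ [])
  decide : ∀ x → (A x × Eval (proj₁ sg∘g-computable) (x ∷ []) 0) ⊎
                 (¬ A x × Eval (proj₁ sg∘g-computable) (x ∷ []) 1)
  decide x with g x in gx
  ... | zero  = inj₁ (sound x gx , subst (Eval _ _) (cong sg gx) (evaluates x))
  ... | suc _ = inj₂ ((λ a → 0≢1+n (trans (sym (complete x a)) gx)) , subst (Eval _ _) (cong sg gx) (evaluates x))

parity : ℕ → ℕ
parity zero    = 0
parity (suc n) = 1 ∸ parity n

half : ℕ → ℕ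
half zero    = 0
half (suc n) = half n + parity n

parity-computable : Computable₁ parity
parity-computable = computable-rec (lit 0) (∸-computable · (lit 1 ∷ arg (# 1) ∷ []))
  (λ { [] → refl }) (λ { k [] → refl })

half-computable : Computable₁ half
half-computable = computable-rec (lit 0) (+-computable · (arg (# 1) ∷ parity-computable · (arg (# 0) ∷ []) ∷ []))
  (λ { [] → refl }) (λ { k [] → refl })

parity-2+ : ∀ n → parity (2 + n) ≡ parity n
parity-2+ zero    = refl
parity-2+ (suc n) = cong (1 ∸_) (parity-2+ n)

half-2+ : ∀ n → half (2 + n) ≡ suc (half n)
half-2+ n = begin
  half n + parity n + (1 ∸ parity n)   ≡⟨ +-assoc (half n) (parity n) _ ⟩
  half n + (parity n + (1 ∸ parity n)) ≡⟨ cong (half n +_) (m+[n∸m]≡n (parity≤1 n)) ⟩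
  half n + 1                           ≡⟨ +-comm (half n) 1 ⟩
  suc (half n)                         ∎
  where
  open ≡-Reasoning
  parity≤1 : ∀ n → parity n ≤ 1
  parity≤1 zero    = z≤n
  parity≤1 (suc n) = m∸n≤m 1 (parity n)

parity-2* : ∀ n → parity (2 * n) ≡ 0
parity-2* zero    = refl
parity-2* (suc n) = trans (cong parity (*-suc 2 n)) (trans (parity-2+ (2 * n)) (parity-2* n))

half-2* : ∀ n → half (2 * n) ≡ n
half-2* zero    = refl
half-2* (suc n) = trans (cong half (*-suc 2 n)) (trans (half-2+ (2 * n)) (cong suc (half-2* n)))

-- pair a b = 2 ^ a * (2 b + 1): unpair₁ counts how often its argument can be halved,
-- unpair₂ reads b off the odd part.
halvable : ℕ → ℕ
halvable x = if0 x then 0 else (if0 parity x then 1 else 0)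

halveEven : ℕ → ℕ
halveEven x = if0 halvable x then x else half x

halveEven^ : ℕ → ℕ → ℕ
halveEven^ zero    x = x
halveEven^ (suc f) x = halveEven (halveEven^ f x)

halvings : ℕ → ℕ → ℕ
halvings zero    x = 0
halvings (suc f) x = halvings f x + halvable (halveEven^ f x)

unpair₁ : ℕ → ℕ
unpair₁ x = halvings x x

unpair₂ : ℕ → ℕ
unpair₂ x = half (pred (halveEven^ x x))

halvable-computable : Computable₁ halvable
halvable-computable = computable-by
  (if0ᵉ arg (# 0) then lit 0 else (if0ᵉ parity-computable · (arg (# 0) ∷ []) then lit 1 else lit 0))
  λ { (x ∷ []) → refl }

halveEven^-computable : Computable₂ halveEven^
halveEven^-computable = computable-rec (arg (# 0)) (halveEven-computable · (arg (# 1) ∷ []))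
  (λ { (x ∷ []) → refl }) (λ { k (x ∷ []) → refl })
  where
  halveEven-computable : Computable₁ halveEven
  halveEven-computable = computable-by
    (if0ᵉ halvable-computable · (arg (# 0) ∷ []) then arg (# 0) else half-computable · (arg (# 0) ∷ []))
    λ { (x ∷ []) → refl }

unpair₁-computable : Computable₁ unpair₁
unpair₁-computable = computable-by (halvings-computable · (arg (# 0) ∷ arg (# 0) ∷ [])) λ { (x ∷ []) → refl }
  where
  halvings-computable : Computable₂ halvings
  halvings-computable = computable-rec (lit 0)
    (+-computable · ( arg (# 1)
                    ∷ halvable-computable · (halveEven^-computable · (arg (# 0) ∷ arg (# 2) ∷ []) ∷ [])
                    ∷ []))
    (λ { (x ∷ []) → refl }) (λ { k (x ∷ []) → refl })

unpair₂-computable : Computable₁ unpair₂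
unpair₂-computable = computable-by
  (half-computable · (predᵉ (halveEven^-computable · (arg (# 0) ∷ arg (# 0) ∷ [])) ∷ []))
  λ { (x ∷ []) → refl }

pair-zero : ∀ b → pair 0 b ≡ suc (2 * b)
pair-zero b = *-identityˡ (suc (2 * b))

pair-suc : ∀ a b → pair (suc a) b ≡ 2 * pair a b
pair-suc a b = *-assoc 2 (2 ^ a) (suc (2 * b))

pair>0 : ∀ a b → 0 < pair a b
pair>0 a b = *-mono-≤ (m^n>0 2 a) (s≤s z≤n)

halvable-odd : ∀ b → halvable (suc (2 * b)) ≡ 0
halvable-odd b = cong (λ p → if0 1 ∸ p then 1 else 0) (parity-2* b)

halvable-2*suc : ∀ p → halvable (2 * suc p) ≡ 1
halvable-2*suc p = cong (λ q → if0 q then 1 else 0) (parity-2* (suc p))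

halvable-pair : ∀ a b → halvable (pair a b) ≡ sg a
halvable-pair zero    b = trans (cong halvable (pair-zero b)) (halvable-odd b)
halvable-pair (suc a) b with pair a b | pair>0 a b | pair-suc a b
... | suc p | _ | eq = trans (cong halvable eq) (halvable-2*suc p)

halveEven-pair : ∀ a b → halveEven (pair a b) ≡ pair (pred a) b
halveEven-pair zero b = begin
  halveEven (pair 0 b)     ≡⟨ cong halveEven (pair-zero b) ⟩
  halveEven (suc (2 * b))  ≡⟨ cong (λ h → if0 h then suc (2 * b) else half (suc (2 * b))) (halvable-odd b) ⟩
  suc (2 * b)              ≡⟨ pair-zero b ⟨
  pair 0 b                 ∎
  where open ≡-Reasoning
halveEven-pair (suc a) b with pair a b | pair>0 a b | pair-suc a b
... | suc p | _ | eq = begin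
  halveEven (pair (suc a) b) ≡⟨ cong halveEven eq ⟩
  halveEven (2 * suc p)      ≡⟨ cong (λ h → if0 h then 2 * suc p else half (2 * suc p)) (halvable-2*suc p) ⟩
  half (2 * suc p)           ≡⟨ half-2* (suc p) ⟩
  suc p                      ∎
  where open ≡-Reasoning

halveEven^-pair : ∀ f a b → halveEven^ f (pair a b) ≡ pair (a ∸ f) b
halveEven^-pair zero    a b = refl
halveEven^-pair (suc f) a b = begin
  halveEven (halveEven^ f (pair a b)) ≡⟨ cong halveEven (halveEven^-pair f a b) ⟩
  halveEven (pair (a ∸ f) b)          ≡⟨ halveEven-pair (a ∸ f) b ⟩
  pair (pred (a ∸ f)) b               ≡⟨ cong (λ c → pair c b) (pred[m∸n]≡m∸[1+n] a f) ⟩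
  pair (a ∸ suc f) b                  ∎
  where open ≡-Reasoning

halvings-pair : ∀ f a b → halvings f (pair a b) ≡ f ⊓ a
halvings-pair zero    a b = refl
halvings-pair (suc f) a b = begin
  halvings f (pair a b) + halvable (halveEven^ f (pair a b))
    ≡⟨ cong₂ _+_ (halvings-pair f a b) (trans (cong halvable (halveEven^-pair f a b)) (halvable-pair (a ∸ f) b)) ⟩
  f ⊓ a + sg (a ∸ f)
    ≡⟨ ⊓-+-sg f a ⟩
  suc f ⊓ a ∎
  where
  open ≡-Reasoning
  ⊓-+-sg : ∀ f a → f ⊓ a + sg (a ∸ f) ≡ suc f ⊓ a
  ⊓-+-sg zero    zero    = refl
  ⊓-+-sg (suc f) zero    = refl
  ⊓-+-sg zero    (suc a) = refl
  ⊓-+-sg (suc f) (suc a) = cong suc (⊓-+-sg f a)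

n<2^n : ∀ a → a < 2 ^ a
n<2^n zero    = s≤s z≤n
n<2^n (suc a) = begin-strict
  suc a           ≤⟨ n<2^n a ⟩
  2 ^ a           <⟨ m<m+n (2 ^ a) (m^n>0 2 a) ⟩
  2 ^ a + 2 ^ a   ≡⟨ cong (2 ^ a +_) (+-identityʳ (2 ^ a)) ⟨
  2 ^ suc a       ∎
  where open ≤-Reasoning

<-pair₁ : ∀ a b → a < pair a b
<-pair₁ a b = ≤-trans (n<2^n a) (m≤m*n (2 ^ a) (suc (2 * b)))

<-pair₂ : ∀ a b → b < pair a b
<-pair₂ a b = ≤-trans (s≤s (m≤m+n b (b + 0))) (m≤n*m (suc (2 * b)) (2 ^ a) {{m^n≢0 2 a}})

+-<-pair : ∀ a b → a + b < pair a b
+-<-pair a b = begin-strict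
  a + b               ≤⟨ +-monoʳ-≤ a (m≤m+n b (b + 0)) ⟩
  a + 2 * b           <⟨ +-monoˡ-< (2 * b) (n<2^n a) ⟩
  2 ^ a + 2 * b       ≤⟨ +-monoʳ-≤ (2 ^ a) (m≤n*m (2 * b) (2 ^ a) {{m^n≢0 2 a}}) ⟩
  2 ^ a + 2 ^ a * (2 * b) ≡⟨ *-suc (2 ^ a) (2 * b) ⟨
  pair a b            ∎
  where open ≤-Reasoning

unpair₁-pair : ∀ a b → unpair₁ (pair a b) ≡ a
unpair₁-pair a b = trans (halvings-pair (pair a b) a b) (m≥n⇒m⊓n≡n (<⇒≤ (<-pair₁ a b)))

unpair₂-pair : ∀ a b → unpair₂ (pair a b) ≡ b
unpair₂-pair a b = begin
  half (pred (halveEven^ (pair a b) (pair a b)))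
    ≡⟨ cong (half ∘ pred) (halveEven^-pair (pair a b) a b) ⟩
  half (pred (pair (a ∸ pair a b) b))
    ≡⟨ cong (λ c → half (pred (pair c b))) (m≤n⇒m∸n≡0 (<⇒≤ (<-pair₁ a b))) ⟩
  half (pred (pair 0 b))
    ≡⟨ cong (half ∘ pred) (pair-zero b) ⟩
  half (2 * b)
    ≡⟨ half-2* b ⟩
  b ∎
  where open ≡-Reasoning

-- Codes are built with this opaque copy of pair, so that the type checker never
-- tries to normalise them.
opaque
  ⟪_,_⟫ : ℕ → ℕ → ℕ
  ⟪ a , b ⟫ = pair a b

  ⟪⟫≡pair : ∀ a b → ⟪ a , b ⟫ ≡ pair a b
  ⟪⟫≡pair a b = refl

⟪⟫-computable : Computable₂ ⟪_,_⟫
⟪⟫-computable = computable-by (pair-computable · (arg (# 0) ∷ arg (# 1) ∷ []))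
  λ { (a ∷ b ∷ []) → sym (⟪⟫≡pair a b) }

unpair₁-⟪⟫ : ∀ a b → unpair₁ ⟪ a , b ⟫ ≡ a
unpair₁-⟪⟫ a b = trans (cong unpair₁ (⟪⟫≡pair a b)) (unpair₁-pair a b)

unpair₂-⟪⟫ : ∀ a b → unpair₂ ⟪ a , b ⟫ ≡ b
unpair₂-⟪⟫ a b = trans (cong unpair₂ (⟪⟫≡pair a b)) (unpair₂-pair a b)

⟪_,_⟫ᵉ : ∀ {n} → Expr n → Expr n → Expr n
⟪ a , b ⟫ᵉ = ⟪⟫-computable · (a ∷ b ∷ [])

unpair₁ᵉ unpair₂ᵉ : ∀ {n} → Expr n → Expr n
unpair₁ᵉ a = unpair₁-computable · (a ∷ [])
unpair₂ᵉ a = unpair₂-computable · (a ∷ [])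

-- The Gödel numbering computed with the opaque pairing: equations between codes of
-- formulas with free parts can then be checked without normalising numerals.
module _ {L : Lang} where

  codeᵒT : ∀ {n} → Term L n → ℕ
  codeᵒT (var i)   = ⟪ 0 , toℕ i ⟫
  codeᵒT `0        = ⟪ 1 , 0 ⟫
  codeᵒT `1        = ⟪ 2 , 0 ⟫
  codeᵒT (s `+ t)  = ⟪ 3 , ⟪ codeᵒT s , codeᵒT t ⟫ ⟫
  codeᵒT (s `* t)  = ⟪ 4 , ⟪ codeᵒT s , codeᵒT t ⟫ ⟫
  codeᵒT (const c) = ⟪ 5 , toℕ c ⟫

  codeᵒTs : ∀ {n k} → Vec (Term L n) k → ℕ
  codeᵒTs []       = 0
  codeᵒTs (t ∷ ts) = suc ⟪ codeᵒT t , codeᵒTs ts ⟫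

  codeᵒF : ∀ {n} → Formula L n → ℕ
  codeᵒF (s `= t)   = ⟪ 0 , ⟪ codeᵒT s , codeᵒT t ⟫ ⟫
  codeᵒF (s `< t)   = ⟪ 1 , ⟪ codeᵒT s , codeᵒT t ⟫ ⟫
  codeᵒF (rel i ts) = ⟪ 2 , ⟪ toℕ i , codeᵒTs ts ⟫ ⟫
  codeᵒF `⊥         = ⟪ 3 , 0 ⟫
  codeᵒF (φ `∧ ψ)   = ⟪ 4 , ⟪ codeᵒF φ , codeᵒF ψ ⟫ ⟫
  codeᵒF (φ `∨ ψ)   = ⟪ 5 , ⟪ codeᵒF φ , codeᵒF ψ ⟫ ⟫
  codeᵒF (φ `⇒ ψ)   = ⟪ 6 , ⟪ codeᵒF φ , codeᵒF ψ ⟫ ⟫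
  codeᵒF (`∀ φ)     = ⟪ 7 , codeᵒF φ ⟫
  codeᵒF (`∃ φ)     = ⟪ 8 , codeᵒF φ ⟫

  private
    ⟪⟫≡pair-cong : ∀ {a b} a' b' → a ≡ a' → b ≡ b' → ⟪ a , b ⟫ ≡ pair a' b'
    ⟪⟫≡pair-cong a' b' refl refl = ⟪⟫≡pair a' b'

    tagged : ∀ tag {a b} a' b' → a ≡ a' → b ≡ b' → ⟪ tag , ⟪ a , b ⟫ ⟫ ≡ pair tag (pair a' b')
    tagged tag a' b' a≡ b≡ =
      trans (cong ⟪ tag ,_⟫ (⟪⟫≡pair-cong a' b' a≡ b≡)) (⟪⟫≡pair tag (pair a' b'))

  codeᵒT≡codeT : ∀ {n} (t : Term L n) → codeᵒT t ≡ codeT t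
  codeᵒT≡codeT (var i)   = ⟪⟫≡pair 0 (toℕ i)
  codeᵒT≡codeT `0        = ⟪⟫≡pair 1 0
  codeᵒT≡codeT `1        = ⟪⟫≡pair 2 0
  codeᵒT≡codeT (s `+ t)  = tagged 3 (codeT s) (codeT t) (codeᵒT≡codeT s) (codeᵒT≡codeT t)
  codeᵒT≡codeT (s `* t)  = tagged 4 (codeT s) (codeT t) (codeᵒT≡codeT s) (codeᵒT≡codeT t)
  codeᵒT≡codeT (const c) = ⟪⟫≡pair 5 (toℕ c)

  codeᵒTs≡codeTs : ∀ {n k} (ts : Vec (Term L n) k) → codeᵒTs ts ≡ codeTs ts
  codeᵒTs≡codeTs []       = refl
  codeᵒTs≡codeTs (t ∷ ts) =
    cong suc (⟪⟫≡pair-cong (codeT t) (codeTs ts) (codeᵒT≡codeT t) (codeᵒTs≡codeTs ts))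

  codeᵒF≡codeF : ∀ {n} (φ : Formula L n) → codeᵒF φ ≡ codeF φ
  codeᵒF≡codeF (s `= t)   = tagged 0 (codeT s) (codeT t) (codeᵒT≡codeT s) (codeᵒT≡codeT t)
  codeᵒF≡codeF (s `< t)   = tagged 1 (codeT s) (codeT t) (codeᵒT≡codeT s) (codeᵒT≡codeT t)
  codeᵒF≡codeF (rel i ts) = tagged 2 (toℕ i) (codeTs ts) refl (codeᵒTs≡codeTs ts)
  codeᵒF≡codeF `⊥         = ⟪⟫≡pair 3 0
  codeᵒF≡codeF (φ `∧ ψ)   = tagged 4 (codeF φ) (codeF ψ) (codeᵒF≡codeF φ) (codeᵒF≡codeF ψ)
  codeᵒF≡codeF (φ `∨ ψ)   = tagged 5 (codeF φ) (codeF ψ) (codeᵒF≡codeF φ) (codeᵒF≡codeF ψ)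
  codeᵒF≡codeF (φ `⇒ ψ)   = tagged 6 (codeF φ) (codeF ψ) (codeᵒF≡codeF φ) (codeᵒF≡codeF ψ)
  codeᵒF≡codeF (`∀ φ)     = trans (cong ⟪ 7 ,_⟫ (codeᵒF≡codeF φ)) (⟪⟫≡pair 7 (codeF φ))
  codeᵒF≡codeF (`∃ φ)     = trans (cong ⟪ 8 ,_⟫ (codeᵒF≡codeF φ)) (⟪⟫≡pair 8 (codeF φ))

table : (n : ℕ) → (Fin n → ℕ) → ℕ → ℕ
table zero    g i = 0
table (suc n) g i = if0 i then g fz else table n (λ j → g (fs j)) (pred i)

table-computable : ∀ n g → Computable₁ (table n g)
table-computable zero    g = computable-by (lit 0) λ { (i ∷ []) → refl }
table-computable (suc n) g = computable-by
  (if0ᵉ arg (# 0) then lit (g fz) else (table-computable n (λ j → g (fs j)) · (predᵉ (arg (# 0)) ∷ [])))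
  λ { (i ∷ []) → refl }

table-toℕ : ∀ n g (i : Fin n) → table n g (toℕ i) ≡ g i
table-toℕ (suc n) g fz     = refl
table-toℕ (suc n) g (fs i) = table-toℕ n (λ j → g (fs j)) i

module _ {L : Lang} where

  AvoidsT : ∀ {n} → ℕ → Term L n → Set
  AvoidsT f (var i)   = toℕ i ≢ f
  AvoidsT f `0        = ⊤
  AvoidsT f `1        = ⊤
  AvoidsT f (s `+ t)  = AvoidsT f s × AvoidsT f t
  AvoidsT f (s `* t)  = AvoidsT f s × AvoidsT f t
  AvoidsT f (const c) = ⊤

  AvoidsTs : ∀ {n k} → ℕ → Vec (Term L n) k → Set
  AvoidsTs f []       = ⊤
  AvoidsTs f (t ∷ ts) = AvoidsT f t × AvoidsTs f ts

  AvoidsF : ∀ {n} → ℕ → Formula L n → Set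
  AvoidsF f (s `= t)   = AvoidsT f s × AvoidsT f t
  AvoidsF f (s `< t)   = AvoidsT f s × AvoidsT f t
  AvoidsF f (rel i ts) = AvoidsTs f ts
  AvoidsF f `⊥         = ⊤
  AvoidsF f (φ `∧ ψ)   = AvoidsF f φ × AvoidsF f ψ
  AvoidsF f (φ `∨ ψ)   = AvoidsF f φ × AvoidsF f ψ
  AvoidsF f (φ `⇒ ψ)   = AvoidsF f φ × AvoidsF f ψ
  AvoidsF f (`∀ φ)     = AvoidsF (suc f) φ
  AvoidsF f (`∃ φ)     = AvoidsF (suc f) φ

-- The recogniser is a stack machine.  A goal (s , f , k) asks that k code an object of
-- sort s over f + D variables in which variable f does not occur.  A state is 0 (accept),
-- 1 (reject) or a nonempty stack of goals; a step pops the top goal, checks its outermost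
-- constructor and pushes one goal for each immediate subobject.
data Sort : Set where
  term formula : Sort
  terms : ℕ → Sort

sortCode : Sort → ℕ
sortCode term      = 0
sortCode formula   = 1
sortCode (terms n) = 2 + n

Goal : Set
Goal = Sort × ℕ × ℕ

reject : ℕ
reject = 1

goal : ℕ → ℕ → ℕ → ℕ
goal K f k = ⟪ K , ⟪ f , k ⟫ ⟫

push : ℕ → ℕ → ℕ
push g R = 2 + ⟪ g , R ⟫

encode : List Goal → ℕ
encode []                 = 0
encode ((s , f , k) ∷ gs) = push (goal (sortCode s) f k) (encode gs)

whenPair : ℕ → ℕ → ℕ
whenPair k r = if0 eqℕ ⟪ unpair₁ k , unpair₂ k ⟫ k then r else reject

pushPair : ℕ → ℕ → ℕ → ℕ → ℕ → ℕ
pushPair K₁ K₂ k f R = whenPair k (push (goal K₁ f (unpair₁ k)) (push (goal K₂ f (unpair₂ k)) R))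

goalᵉ : ∀ {n} → Expr n → Expr n → Expr n → Expr n
goalᵉ K f k = ⟪ K , ⟪ f , k ⟫ᵉ ⟫ᵉ

pushᵉ whenPairᵉ : ∀ {n} → Expr n → Expr n → Expr n
pushᵉ g R = sucᵉ (sucᵉ ⟪ g , R ⟫ᵉ)
whenPairᵉ k r = if0ᵉ eqᵉ ⟪ unpair₁ᵉ k , unpair₂ᵉ k ⟫ᵉ k then r else lit reject

pushPairᵉ : ∀ {n} → Expr n → Expr n → Expr n → Expr n → Expr n → Expr n
pushPairᵉ K₁ K₂ k f R =
  whenPairᵉ k (pushᵉ (goalᵉ K₁ f (unpair₁ᵉ k)) (pushᵉ (goalᵉ K₂ f (unpair₂ᵉ k)) R))

switchᵉ : ∀ {n} → ℕ → Expr n → List (Expr n) → Expr n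
switchᵉ i tag []       = lit reject
switchᵉ i tag (e ∷ es) = if0ᵉ eqᵉ tag (lit i) then e else switchᵉ (suc i) tag es

module Parser (L : Lang) (D : ℕ) where

  termStep : ℕ → ℕ → ℕ → ℕ → ℕ
  termStep 0 i f R = if0 ltℕ i (f + D) then (if0 eqℕ i f then reject else R) else reject
  termStep 1 b f R = if0 b then R else reject
  termStep 2 b f R = if0 b then R else reject
  termStep 3 b f R = pushPair 0 0 b f R
  termStep 4 b f R = pushPair 0 0 b f R
  termStep 5 c f R = if0 ltℕ c (nConst L) then R else reject
  termStep _ _ _ _ = reject

  arityTable : ℕ → ℕ
  arityTable = table (nRel L) (arity L)

  formulaStep : ℕ → ℕ → ℕ → ℕ → ℕ
  formulaStep 0 b f R = pushPair 0 0 b f R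
  formulaStep 1 b f R = pushPair 0 0 b f R
  formulaStep 2 b f R = whenPair b
    (if0 ltℕ (unpair₁ b) (nRel L) then push (goal (2 + arityTable (unpair₁ b)) f (unpair₂ b)) R else reject)
  formulaStep 3 b f R = if0 b then R else reject
  formulaStep 4 b f R = pushPair 1 1 b f R
  formulaStep 5 b f R = pushPair 1 1 b f R
  formulaStep 6 b f R = pushPair 1 1 b f R
  formulaStep 7 b f R = push (goal 1 (suc f) b) R
  formulaStep 8 b f R = push (goal 1 (suc f) b) R
  formulaStep _ _ _ _ = reject

  termsStep : ℕ → ℕ → ℕ → ℕ → ℕ
  termsStep zero    f zero    R = R
  termsStep zero    f (suc _) R = reject
  termsStep (suc n) f zero    R = reject
  termsStep (suc n) f (suc k) R = pushPair 0 (2 + n) k f R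

  goalStep : ℕ → ℕ → ℕ → ℕ → ℕ
  goalStep 0             f k R = whenPair k (termStep (unpair₁ k) (unpair₂ k) f R)
  goalStep 1             f k R = whenPair k (formulaStep (unpair₁ k) (unpair₂ k) f R)
  goalStep (suc (suc n)) f k R = termsStep n f k R

  step : ℕ → ℕ
  step 0             = 0
  step 1             = 1
  step (suc (suc s)) =
    goalStep (unpair₁ (unpair₁ s)) (unpair₁ (unpair₂ (unpair₁ s))) (unpair₂ (unpair₂ (unpair₁ s))) (unpair₂ s)

  run : ℕ → ℕ → ℕ
  run zero    s = s
  run (suc n) s = step (run n s)

  termStep-computable : Computable₄ termStep
  termStep-computable = computable-by
    (switchᵉ 0 tag
      ( (if0ᵉ ltᵉ body (+-computable · (f ∷ lit D ∷ []))
         then (if0ᵉ eqᵉ body f then lit reject else R)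
         else lit reject)
      ∷ (if0ᵉ body then R else lit reject)
      ∷ (if0ᵉ body then R else lit reject)
      ∷ pushPairᵉ (lit 0) (lit 0) body f R
      ∷ pushPairᵉ (lit 0) (lit 0) body f R
      ∷ (if0ᵉ ltᵉ body (lit (nConst L)) then R else lit reject)
      ∷ []))
    λ { (0 ∷ b ∷ f ∷ R ∷ []) → refl
      ; (1 ∷ b ∷ f ∷ R ∷ []) → refl
      ; (2 ∷ b ∷ f ∷ R ∷ []) → refl
      ; (3 ∷ b ∷ f ∷ R ∷ []) → refl
      ; (4 ∷ b ∷ f ∷ R ∷ []) → refl
      ; (5 ∷ b ∷ f ∷ R ∷ []) → refl
      ; (suc (suc (suc (suc (suc (suc _))))) ∷ b ∷ f ∷ R ∷ []) → refl }
    where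
    tag body f R : Expr 4
    tag  = arg (# 0)
    body = arg (# 1)
    f    = arg (# 2)
    R    = arg (# 3)

  formulaStep-computable : Computable₄ formulaStep
  formulaStep-computable = computable-by
    (switchᵉ 0 tag
      ( pushPairᵉ (lit 0) (lit 0) body f R
      ∷ pushPairᵉ (lit 0) (lit 0) body f R
      ∷ whenPairᵉ body
          (if0ᵉ ltᵉ (unpair₁ᵉ body) (lit (nRel L))
           then pushᵉ (goalᵉ (sucᵉ (sucᵉ arityᵉ)) f (unpair₂ᵉ body)) R
           else lit reject)
      ∷ (if0ᵉ body then R else lit reject)
      ∷ pushPairᵉ (lit 1) (lit 1) body f R
      ∷ pushPairᵉ (lit 1) (lit 1) body f R
      ∷ pushPairᵉ (lit 1) (lit 1) body f R
      ∷ pushᵉ (goalᵉ (lit 1) (sucᵉ f) body) R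
      ∷ pushᵉ (goalᵉ (lit 1) (sucᵉ f) body) R
      ∷ []))
    λ { (0 ∷ b ∷ f ∷ R ∷ []) → refl
      ; (1 ∷ b ∷ f ∷ R ∷ []) → refl
      ; (2 ∷ b ∷ f ∷ R ∷ []) → refl
      ; (3 ∷ b ∷ f ∷ R ∷ []) → refl
      ; (4 ∷ b ∷ f ∷ R ∷ []) → refl
      ; (5 ∷ b ∷ f ∷ R ∷ []) → refl
      ; (6 ∷ b ∷ f ∷ R ∷ []) → refl
      ; (7 ∷ b ∷ f ∷ R ∷ []) → refl
      ; (8 ∷ b ∷ f ∷ R ∷ []) → refl
      ; (suc (suc (suc (suc (suc (suc (suc (suc (suc _)))))))) ∷ b ∷ f ∷ R ∷ []) → refl }
    where
    tag body f R arityᵉ : Expr 4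
    tag  = arg (# 0)
    body = arg (# 1)
    f    = arg (# 2)
    R    = arg (# 3)
    arityᵉ = table-computable (nRel L) (arity L) · (unpair₁ᵉ body ∷ [])

  termsStep-computable : Computable₄ termsStep
  termsStep-computable = computable-by
    (if0ᵉ k then (if0ᵉ n then R else lit reject)
     else (if0ᵉ n then lit reject else pushPairᵉ (lit 0) (sucᵉ n) (predᵉ k) f R))
    λ { (zero  ∷ f ∷ zero  ∷ R ∷ []) → refl
      ; (zero  ∷ f ∷ suc k ∷ R ∷ []) → refl
      ; (suc n ∷ f ∷ zero  ∷ R ∷ []) → refl
      ; (suc n ∷ f ∷ suc k ∷ R ∷ []) → refl }
    where
    n f k R : Expr 4
    n = arg (# 0)
    f = arg (# 1)
    k = arg (# 2)
    R = arg (# 3)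

  goalStep-computable : Computable₄ goalStep
  goalStep-computable = computable-by
    (if0ᵉ K then whenPairᵉ k (termStep-computable · (unpair₁ᵉ k ∷ unpair₂ᵉ k ∷ f ∷ R ∷ []))
     else (if0ᵉ predᵉ K then whenPairᵉ k (formulaStep-computable · (unpair₁ᵉ k ∷ unpair₂ᵉ k ∷ f ∷ R ∷ []))
           else termsStep-computable · (predᵉ (predᵉ K) ∷ f ∷ k ∷ R ∷ [])))
    λ { (0 ∷ f ∷ k ∷ R ∷ []) → refl
      ; (1 ∷ f ∷ k ∷ R ∷ []) → refl
      ; (suc (suc n) ∷ f ∷ k ∷ R ∷ []) → refl }
    where
    K f k R : Expr 4
    K = arg (# 0)
    f = arg (# 1)
    k = arg (# 2)
    R = arg (# 3)

  run-computable : Computable₂ run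
  run-computable = computable-rec (arg (# 0)) (step-computable · (arg (# 1) ∷ []))
    (λ { (s ∷ []) → refl }) (λ { n (s ∷ []) → refl })
    where
    step-computable : Computable₁ step
    step-computable = computable-by
      (if0ᵉ s then lit 0 else (if0ᵉ predᵉ s then lit 1 else
        goalStep-computable · ( unpair₁ᵉ (unpair₁ᵉ t) ∷ unpair₁ᵉ (unpair₂ᵉ (unpair₁ᵉ t))
                              ∷ unpair₂ᵉ (unpair₂ᵉ (unpair₁ᵉ t)) ∷ unpair₂ᵉ t ∷ [])))
      λ { (0 ∷ []) → refl ; (1 ∷ []) → refl ; (suc (suc s) ∷ []) → refl }
      where
      s t : Expr 1
      s = arg (# 0)
      t = predᵉ (predᵉ s)

  Syntax : Sort → ℕ → Set
  Syntax term      n = Term L n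
  Syntax formula   n = Formula L n
  Syntax (terms k) n = Vec (Term L n) k

  code : ∀ s {n} → Syntax s n → ℕ
  code term      = codeT
  code formula   = codeF
  code (terms k) = codeTs

  Avoids : ∀ s {n} → ℕ → Syntax s n → Set
  Avoids term      = AvoidsT
  Avoids formula   = AvoidsF
  Avoids (terms k) = AvoidsTs

  Valid : Goal → Set
  Valid (s , f , k) = Σ (Syntax s (f + D)) λ e → Avoids s f e × code s e ≡ k

  step-push : ∀ K f k R → step (push (goal K f k) R) ≡ goalStep K f k R
  step-push K f k R
    rewrite unpair₁-⟪⟫ (goal K f k) R | unpair₂-⟪⟫ (goal K f k) R
          | unpair₁-⟪⟫ K ⟪ f , k ⟫    | unpair₂-⟪⟫ K ⟪ f , k ⟫
          | unpair₁-⟪⟫ f k            | unpair₂-⟪⟫ f k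
          = refl

  whenPair-cases : ∀ k r → whenPair k r ≡ reject ⊎ (⟪ unpair₁ k , unpair₂ k ⟫ ≡ k × whenPair k r ≡ r)
  whenPair-cases k r with eqℕ ⟪ unpair₁ k , unpair₂ k ⟫ k in eq
  ... | zero  = inj₂ (eqℕ≡0⇒≡ eq , refl)
  ... | suc _ = inj₁ refl

  whenPair-pair : ∀ a b r → whenPair (pair a b) r ≡ r
  whenPair-pair a b r = cong (if0_then r else reject) (begin
    eqℕ ⟪ unpair₁ (pair a b) , unpair₂ (pair a b) ⟫ (pair a b)
      ≡⟨ cong₂ (λ x y → eqℕ ⟪ x , y ⟫ (pair a b)) (unpair₁-pair a b) (unpair₂-pair a b) ⟩
    eqℕ ⟪ a , b ⟫ (pair a b)
      ≡⟨ cong (λ x → eqℕ x (pair a b)) (⟪⟫≡pair a b) ⟩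
    eqℕ (pair a b) (pair a b)
      ≡⟨ eqℕ-refl (pair a b) ⟩
    0 ∎)
    where open ≡-Reasoning

  Sound : Goal → List Goal → ℕ → Set
  Sound g gs v = v ≡ reject ⊎ Σ (List Goal) λ cs → v ≡ encode (cs ++ gs) × (All Valid cs → Valid g)

  leaf-code : ∀ {tag b k u} → u ≡ b → ⟪ tag , b ⟫ ≡ k → pair tag u ≡ k
  leaf-code {tag} refl eq = trans (sym (⟪⟫≡pair tag _)) eq

  node-code : ∀ {tag b k u v} → ⟪ u , v ⟫ ≡ b → ⟪ tag , b ⟫ ≡ k → pair tag (pair u v) ≡ k
  node-code {u = u} {v} uv≡b = leaf-code (trans (sym (⟪⟫≡pair u v)) uv≡b)

  pushPair-sound : ∀ {s s₁ s₂ f b k gs} (node : Syntax s₁ (f + D) → Syntax s₂ (f + D) → Syntax s (f + D)) →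
                   (∀ {x y} → ⟪ code s₁ x , code s₂ y ⟫ ≡ b → code s (node x y) ≡ k) →
                   (∀ {x y} → Avoids s₁ f x → Avoids s₂ f y → Avoids s f (node x y)) →
                   Sound (s , f , k) gs (pushPair (sortCode s₁) (sortCode s₂) b f (encode gs))
  pushPair-sound {s₁ = s₁} {s₂} {f} {b} {gs = gs} node node-code node-avoids
    with whenPair-cases b (encode ((s₁ , f , unpair₁ b) ∷ (s₂ , f , unpair₂ b) ∷ gs))
  ... | inj₁ rejected        = inj₁ rejected
  ... | inj₂ (b-pair , eq) = inj₂ ((s₁ , f , unpair₁ b) ∷ (s₂ , f , unpair₂ b) ∷ [] , eq ,
    λ { ((x , ax , cx) ∷ (y , ay , cy) ∷ []) →
          node x y , node-avoids ax ay , node-code (trans (cong₂ ⟪_,_⟫ cx cy) b-pair) })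

  push-sound : ∀ {s s₁ f f₁ b k gs} → (Valid (s₁ , f₁ , b) → Valid (s , f , k)) →
               Sound (s , f , k) gs (push (goal (sortCode s₁) f₁ b) (encode gs))
  push-sound {s₁ = s₁} {f₁ = f₁} {b} child⇒parent =
    inj₂ ((s₁ , f₁ , b) ∷ [] , refl , λ { (v ∷ []) → child⇒parent v })

  leaf-sound : ∀ {s f k gs} (e : Syntax s (f + D)) → Avoids s f e → code s e ≡ k → Sound (s , f , k) gs (encode gs)
  leaf-sound e ae ce = inj₂ ([] , refl , λ _ → e , ae , ce)

  termStep-sound : ∀ tag b f gs {k} → ⟪ tag , b ⟫ ≡ k → Sound (term , f , k) gs (termStep tag b f (encode gs))
  termStep-sound 0 i f gs eq with ltℕ i (f + D) in i<f+D | eqℕ i f in i≟f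
  ... | suc _ | _     = inj₁ refl
  ... | zero  | zero  = inj₁ refl
  ... | zero  | suc _ = leaf-sound (var (fromℕ< i<)) i≢f (leaf-code (toℕ-fromℕ< i<) eq)
    where
    i< : i < f + D
    i< = ltℕ≡0⇒< i<f+D
    i≢f : toℕ (fromℕ< i<) ≢ f
    i≢f p = 0≢1+n (trans (sym (≡⇒eqℕ≡0 (trans (sym (toℕ-fromℕ< i<)) p))) i≟f)
  termStep-sound 1 zero    f gs eq = leaf-sound `0 tt (leaf-code refl eq)
  termStep-sound 1 (suc _) f gs eq = inj₁ refl
  termStep-sound 2 zero    f gs eq = leaf-sound `1 tt (leaf-code refl eq)
  termStep-sound 2 (suc _) f gs eq = inj₁ refl
  termStep-sound 3 b f gs eq = pushPair-sound _`+_ (λ c → node-code c eq) _,_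
  termStep-sound 4 b f gs eq = pushPair-sound _`*_ (λ c → node-code c eq) _,_
  termStep-sound 5 c f gs eq with ltℕ c (nConst L) in c<
  ... | zero  = leaf-sound (const (fromℕ< (ltℕ≡0⇒< c<))) tt (leaf-code (toℕ-fromℕ< (ltℕ≡0⇒< c<)) eq)
  ... | suc _ = inj₁ refl
  termStep-sound (suc (suc (suc (suc (suc (suc _)))))) b f gs eq = inj₁ refl

  retype : ∀ {a a' f k} → a ≡ a' → Valid (terms a , f , k) → Valid (terms a' , f , k)
  retype refl v = v

  formulaStep-sound : ∀ tag b f gs {k} → ⟪ tag , b ⟫ ≡ k →
                      Sound (formula , f , k) gs (formulaStep tag b f (encode gs))
  formulaStep-sound 0 b f gs eq = pushPair-sound _`=_ (λ c → node-code c eq) _,_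
  formulaStep-sound 1 b f gs eq = pushPair-sound _`<_ (λ c → node-code c eq) _,_
  formulaStep-sound 2 b f gs eq with whenPair-cases b (if0 ltℕ (unpair₁ b) (nRel L)
    then push (goal (2 + arityTable (unpair₁ b)) f (unpair₂ b)) (encode gs) else reject)
  ... | inj₁ rejected = inj₁ rejected
  ... | inj₂ (b-pair , e) with ltℕ (unpair₁ b) (nRel L) in i<
  ...   | suc _ = inj₁ e
  ...   | zero  = subst (Sound _ gs) (sym e) (push-sound (rel-valid ∘ retype arity-j))
    where
    j : Fin (nRel L)
    j = fromℕ< (ltℕ≡0⇒< i<)
    arity-j : arityTable (unpair₁ b) ≡ arity L j
    arity-j = trans (cong arityTable (sym (toℕ-fromℕ< _))) (table-toℕ (nRel L) (arity L) j)
    rel-valid : Valid (terms (arity L j) , f , unpair₂ b) → Valid (formula , f , _)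
    rel-valid (ts , ats , cts) = rel j ts , ats , node-code (trans (cong₂ ⟪_,_⟫ (toℕ-fromℕ< _) cts) b-pair) eq
  formulaStep-sound 3 zero    f gs eq = leaf-sound `⊥ tt (leaf-code refl eq)
  formulaStep-sound 3 (suc _) f gs eq = inj₁ refl
  formulaStep-sound 4 b f gs eq = pushPair-sound _`∧_ (λ c → node-code c eq) _,_
  formulaStep-sound 5 b f gs eq = pushPair-sound _`∨_ (λ c → node-code c eq) _,_
  formulaStep-sound 6 b f gs eq = pushPair-sound _`⇒_ (λ c → node-code c eq) _,_
  formulaStep-sound 7 b f gs {k} eq =
    push-sound {s₁ = formula} {k = k} λ { (φ , aφ , cφ) → `∀ {n = f + D} φ , aφ , leaf-code cφ eq }
  formulaStep-sound 8 b f gs {k} eq =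
    push-sound {s₁ = formula} {k = k} λ { (φ , aφ , cφ) → `∃ {n = f + D} φ , aφ , leaf-code cφ eq }
  formulaStep-sound (suc (suc (suc (suc (suc (suc (suc (suc (suc _))))))))) b f gs eq = inj₁ refl

  termsStep-sound : ∀ n f k gs → Sound (terms n , f , k) gs (termsStep n f k (encode gs))
  termsStep-sound zero    f zero    gs = leaf-sound [] tt refl
  termsStep-sound zero    f (suc _) gs = inj₁ refl
  termsStep-sound (suc n) f zero    gs = inj₁ refl
  termsStep-sound (suc n) f (suc k) gs = pushPair-sound _∷_ (λ c → cong suc (trans (sym (⟪⟫≡pair _ _)) c)) _,_

  step-sound : ∀ g gs → Sound g gs (step (encode (g ∷ gs)))
  step-sound (s , f , k) gs rewrite step-push (sortCode s) f k (encode gs) = goalStep-sound s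
    where
    goalStep-sound : ∀ s → Sound (s , f , k) gs (goalStep (sortCode s) f k (encode gs))
    goalStep-sound term with whenPair-cases k (termStep (unpair₁ k) (unpair₂ k) f (encode gs))
    ... | inj₁ rejected      = inj₁ rejected
    ... | inj₂ (k-pair , e) = subst (Sound _ gs) (sym e) (termStep-sound _ _ f gs k-pair)
    goalStep-sound formula with whenPair-cases k (formulaStep (unpair₁ k) (unpair₂ k) f (encode gs))
    ... | inj₁ rejected      = inj₁ rejected
    ... | inj₂ (k-pair , e) = subst (Sound _ gs) (sym e) (formulaStep-sound _ _ f gs k-pair)
    goalStep-sound (terms n) = termsStep-sound n f k gs

  size : Goal → ℕ
  size (_ , _ , k) = suc k

  record Complete (g : Goal) (gs : List Goal) (v : ℕ) : Set where
    constructor complete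
    field
      children : List Goal
      next     : v ≡ encode (children ++ gs)
      valid    : All Valid children
      smaller  : sum (map size children) < size g

  leaf-complete : ∀ {g gs} → Complete g gs (encode gs)
  leaf-complete = complete [] refl [] (s≤s z≤n)

  push-complete : ∀ {s s₁ f f₁ b k gs} → b < k → Valid (s₁ , f₁ , b) →
                  Complete (s , f , k) gs (push (goal (sortCode s₁) f₁ b) (encode gs))
  push-complete {s₁ = s₁} {f₁ = f₁} {b} b<k v =
    complete ((s₁ , f₁ , b) ∷ []) refl (v ∷ []) (s≤s (subst (_< _) (sym (+-identityʳ b)) b<k))

  pushPair-complete : ∀ {s s₁ s₂ f u v k gs} → pair u v < k → Valid (s₁ , f , u) → Valid (s₂ , f , v) →
                      Complete (s , f , k) gs (pushPair (sortCode s₁) (sortCode s₂) (pair u v) f (encode gs))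
  pushPair-complete {s₁ = s₁} {s₂} {f} {u} {v} {k} {gs} uv<k vu vv =
    complete ((s₁ , f , u) ∷ (s₂ , f , v) ∷ []) unpaired (vu ∷ vv ∷ [])
      (s≤s (subst (_≤ k) (sym sizes) (≤-trans (s≤s (+-<-pair u v)) uv<k)))
    where
    unpaired : pushPair (sortCode s₁) (sortCode s₂) (pair u v) f (encode gs)
             ≡ encode ((s₁ , f , u) ∷ (s₂ , f , v) ∷ gs)
    unpaired = trans (whenPair-pair u v _)
      (cong₂ (λ x y → push (goal (sortCode s₁) f x) (push (goal (sortCode s₂) f y) (encode gs)))
             (unpair₁-pair u v) (unpair₂-pair u v))
    sizes : suc u + (suc v + 0) ≡ 2 + (u + v)
    sizes = cong suc (trans (cong (u +_) (+-identityʳ (suc v))) (+-suc u v))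

  -- u and v are explicit: solving for them against a code would normalise numerals.
  node-complete : ∀ {s s₁ s₂ f gs} tag u v → Valid (s₁ , f , u) → Valid (s₂ , f , v) →
                  Complete (s , f , pair tag (pair u v)) gs
                           (pushPair (sortCode s₁) (sortCode s₂) (pair u v) f (encode gs))
  node-complete tag u v = pushPair-complete (<-pair₂ tag (pair u v))

  dispatch-pair : ∀ (h : ℕ → ℕ → ℕ) a b →
                  whenPair (pair a b) (h (unpair₁ (pair a b)) (unpair₂ (pair a b))) ≡ h a b
  dispatch-pair h a b = trans (whenPair-pair a b _) (cong₂ h (unpair₁-pair a b) (unpair₂-pair a b))

  termStep-complete : ∀ f (t : Term L (f + D)) → AvoidsT f t → ∀ gs →
                      Complete (term , f , codeT t) gs (goalStep 0 f (codeT t) (encode gs))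
  termStep-complete f t at gs = by-tag t at
    where
    R : ℕ
    R = encode gs
    via : ∀ tag b → Complete (term , f , pair tag b) gs (termStep tag b f R) →
          Complete (term , f , pair tag b) gs (goalStep 0 f (pair tag b) R)
    via tag b = subst (Complete (term , f , pair tag b) gs) (sym (dispatch-pair (λ x y → termStep x y f R) tag b))
    var-complete : ∀ (j : Fin (f + D)) → toℕ j ≢ f →
                   Complete (term , f , pair 0 (toℕ j)) gs (termStep 0 (toℕ j) f R)
    var-complete j j≢f rewrite <⇒ltℕ≡0 (toℕ<n j) | eqℕ-≢ j≢f = leaf-complete
    const-complete : ∀ (c : Fin (nConst L)) → Complete (term , f , pair 5 (toℕ c)) gs (termStep 5 (toℕ c) f R)
    const-complete c rewrite <⇒ltℕ≡0 (toℕ<n c) = leaf-complete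
    by-tag : (t : Term L (f + D)) → AvoidsT f t → Complete (term , f , codeT t) gs (goalStep 0 f (codeT t) R)
    by-tag (var j)   j≢f        = via 0 (toℕ j) (var-complete j j≢f)
    by-tag `0        _          = via 1 0 leaf-complete
    by-tag `1        _          = via 2 0 leaf-complete
    by-tag (s `+ t)  (as , at)  =
      via 3 (pair (codeT s) (codeT t)) (node-complete 3 (codeT s) (codeT t) (s , as , refl) (t , at , refl))
    by-tag (s `* t)  (as , at)  =
      via 4 (pair (codeT s) (codeT t)) (node-complete 4 (codeT s) (codeT t) (s , as , refl) (t , at , refl))
    by-tag (const c) _          = via 5 (toℕ c) (const-complete c)

  formulaStep-complete : ∀ f (φ : Formula L (f + D)) → AvoidsF f φ → ∀ gs →
                         Complete (formula , f , codeF φ) gs (goalStep 1 f (codeF φ) (encode gs))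
  formulaStep-complete f φ aφ gs = by-tag φ aφ
    where
    R : ℕ
    R = encode gs
    via : ∀ tag b → Complete (formula , f , pair tag b) gs (formulaStep tag b f R) →
          Complete (formula , f , pair tag b) gs (goalStep 1 f (pair tag b) R)
    via tag b = subst (Complete (formula , f , pair tag b) gs) (sym (dispatch-pair (λ x y → formulaStep x y f R) tag b))
    rel-complete : ∀ (j : Fin (nRel L)) (ts : Vec (Term L (f + D)) (arity L j)) → AvoidsTs f ts →
                   Complete (formula , f , pair 2 (pair (toℕ j) (codeTs ts))) gs
                            (formulaStep 2 (pair (toℕ j) (codeTs ts)) f R)
    rel-complete j ts ats
      rewrite dispatch-pair (λ x y → if0 ltℕ x (nRel L) then push (goal (2 + arityTable x) f y) R else reject)
                            (toℕ j) (codeTs ts)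
            | <⇒ltℕ≡0 (toℕ<n j) | table-toℕ (nRel L) (arity L) j
      = push-complete (<-trans (<-pair₂ (toℕ j) _) (<-pair₂ 2 _)) (ts , ats , refl)
    by-tag : (φ : Formula L (f + D)) → AvoidsF f φ → Complete (formula , f , codeF φ) gs (goalStep 1 f (codeF φ) R)
    by-tag (s `= t)   (as , at) =
      via 0 (pair (codeT s) (codeT t)) (node-complete 0 (codeT s) (codeT t) (s , as , refl) (t , at , refl))
    by-tag (s `< t)   (as , at) =
      via 1 (pair (codeT s) (codeT t)) (node-complete 1 (codeT s) (codeT t) (s , as , refl) (t , at , refl))
    by-tag (rel j ts) ats       = via 2 (pair (toℕ j) (codeTs ts)) (rel-complete j ts ats)
    by-tag `⊥         _         = via 3 0 leaf-complete
    by-tag (φ `∧ ψ)   (aφ , aψ) =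
      via 4 (pair (codeF φ) (codeF ψ)) (node-complete 4 (codeF φ) (codeF ψ) (φ , aφ , refl) (ψ , aψ , refl))
    by-tag (φ `∨ ψ)   (aφ , aψ) =
      via 5 (pair (codeF φ) (codeF ψ)) (node-complete 5 (codeF φ) (codeF ψ) (φ , aφ , refl) (ψ , aψ , refl))
    by-tag (φ `⇒ ψ)   (aφ , aψ) =
      via 6 (pair (codeF φ) (codeF ψ)) (node-complete 6 (codeF φ) (codeF ψ) (φ , aφ , refl) (ψ , aψ , refl))
    by-tag (`∀ φ)     aφ        = via 7 (codeF φ) (push-complete (<-pair₂ 7 _) (φ , aφ , refl))
    by-tag (`∃ φ)     aφ        = via 8 (codeF φ) (push-complete (<-pair₂ 8 _) (φ , aφ , refl))

  termsStep-complete : ∀ {n} f (ts : Vec (Term L (f + D)) n) → AvoidsTs f ts → ∀ gs →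
                       Complete (terms n , f , codeTs ts) gs (termsStep n f (codeTs ts) (encode gs))
  termsStep-complete f []       _         gs = leaf-complete
  termsStep-complete f (t ∷ ts) (at , ats) gs = pushPair-complete ≤-refl (t , at , refl) (ts , ats , refl)

  step-complete : ∀ g gs → Valid g → Complete g gs (step (encode (g ∷ gs)))
  step-complete (s , f , k) gs v rewrite step-push (sortCode s) f k (encode gs) = goalStep-complete s v
    where
    goalStep-complete : ∀ s → Valid (s , f , k) → Complete (s , f , k) gs (goalStep (sortCode s) f k (encode gs))
    goalStep-complete term      (t , at , refl)   = termStep-complete f t at gs
    goalStep-complete formula   (φ , aφ , refl)   = formulaStep-complete f φ aφ gs
    goalStep-complete (terms n) (ts , ats , refl) = termsStep-complete f ts ats gs

  run-step : ∀ n s → run n (step s) ≡ run (suc n) s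
  run-step zero    s = refl
  run-step (suc n) s = cong step (run-step n s)

  run-reject : ∀ n → run n reject ≡ reject
  run-reject zero    = refl
  run-reject (suc n) = cong step (run-reject n)

  run-accept : ∀ n → run n 0 ≡ 0
  run-accept zero    = refl
  run-accept (suc n) = cong step (run-accept n)

  run-sound : ∀ n gs → run n (encode gs) ≡ 0 → All Valid gs
  run-sound _       []       _ = []
  run-sound (suc n) (g ∷ gs) accepted with step-sound g gs
  ... | inj₁ rejected = contradiction (trans (sym (run-reject n)) (trans (cong (run n) (sym rejected)) accepted′)) λ ()
    where
    accepted′ : run n (step (encode (g ∷ gs))) ≡ 0
    accepted′ = trans (run-step n _) accepted
  ... | inj₂ (cs , next , cs⇒g) with ++⁻ cs (run-sound n (cs ++ gs) (trans (cong (run n) (sym next)) accepted′))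
    where
    accepted′ : run n (step (encode (g ∷ gs))) ≡ 0
    accepted′ = trans (run-step n _) accepted
  ...   | vcs , vgs = cs⇒g vcs ∷ vgs

  run-complete : ∀ n gs → All Valid gs → sum (map size gs) ≤ n → run n (encode gs) ≡ 0
  run-complete n       []                 _          _  = run-accept n
  run-complete (suc n) (g@(_ , _ , _) ∷ gs) (vg ∷ vgs) le with step-complete g gs vg
  ... | complete cs next vcs smaller =
    trans (sym (run-step n _)) (trans (cong (run n) next) (run-complete n (cs ++ gs) (++⁺ vcs vgs) bound))
    where
    bound : sum (map size (cs ++ gs)) ≤ n
    bound = ≤-pred (begin-strict
      sum (map size (cs ++ gs))                   ≡⟨ cong sum (map-++ size cs gs) ⟩
      sum (map size cs ++ map size gs)            ≡⟨ sum-++ (map size cs) _ ⟩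
      sum (map size cs) + sum (map size gs)       <⟨ +-monoˡ-< _ smaller ⟩
      size g + sum (map size gs)                  ≤⟨ le ⟩
      suc n                                       ∎)
      where open ≤-Reasoning

  -- Every step strictly decreases the total size of the stack, so suc k steps suffice.
  avoidingFormulaℕ : ℕ → ℕ → ℕ
  avoidingFormulaℕ f k = run (suc k) (encode ((formula , f , k) ∷ []))

  avoidingFormulaℕ-computable : Computable₂ avoidingFormulaℕ
  avoidingFormulaℕ-computable = computable-by
    (run-computable · (sucᵉ (arg (# 1)) ∷ pushᵉ (goalᵉ (lit 1) (arg (# 0)) (arg (# 1))) (lit 0) ∷ []))
    λ { (f ∷ k ∷ []) → refl }

  avoidingFormulaℕ-sound : ∀ f k → avoidingFormulaℕ f k ≡ 0 → Valid (formula , f , k)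
  avoidingFormulaℕ-sound f k accepted with run-sound (suc k) ((formula , f , k) ∷ []) accepted
  ... | v ∷ [] = v

  avoidingFormulaℕ-complete : ∀ f k → Valid (formula , f , k) → avoidingFormulaℕ f k ≡ 0
  avoidingFormulaℕ-complete f k v = run-complete (suc k) _ (v ∷ []) (≤-reflexive (+-identityʳ (suc k)))

renF : ∀ {L m n} → (Fin m → Fin n) → Formula L m → Formula L n
renF ρ (s `= t)   = renT ρ s `= renT ρ t
renF ρ (s `< t)   = renT ρ s `< renT ρ t
renF ρ (rel i ts) = rel i (renTs ρ ts)
renF ρ `⊥         = `⊥
renF ρ (φ `∧ ψ)   = renF ρ φ `∧ renF ρ ψ
renF ρ (φ `∨ ψ)   = renF ρ φ `∨ renF ρ ψ
renF ρ (φ `⇒ ψ)   = renF ρ φ `⇒ renF ρ ψ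
renF ρ (`∀ φ)     = `∀ (renF (liftRen ρ) φ)
renF ρ (`∃ φ)     = `∃ (renF (liftRen ρ) φ)

liftRen-avoids : ∀ {m n f} {ρ : Fin m → Fin n} → (∀ i → toℕ (ρ i) ≢ f) →
                 ∀ i → toℕ (liftRen ρ i) ≢ suc f
liftRen-avoids avoid fz     ()
liftRen-avoids avoid (fs i) eq = avoid i (suc-injective eq)

module _ {L : Lang} where

  AvoidsT-ren : ∀ {m n f} {ρ : Fin m → Fin n} → (∀ i → toℕ (ρ i) ≢ f) → ∀ t → AvoidsT {L} f (renT ρ t)
  AvoidsT-ren avoid (var i)   = avoid i
  AvoidsT-ren avoid `0        = _
  AvoidsT-ren avoid `1        = _
  AvoidsT-ren avoid (s `+ t)  = AvoidsT-ren avoid s , AvoidsT-ren avoid t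
  AvoidsT-ren avoid (s `* t)  = AvoidsT-ren avoid s , AvoidsT-ren avoid t
  AvoidsT-ren avoid (const c) = _

  AvoidsTs-ren : ∀ {m n f k} {ρ : Fin m → Fin n} → (∀ i → toℕ (ρ i) ≢ f) →
                 (ts : Vec (Term L m) k) → AvoidsTs f (renTs ρ ts)
  AvoidsTs-ren avoid []       = _
  AvoidsTs-ren avoid (t ∷ ts) = AvoidsT-ren avoid t , AvoidsTs-ren avoid ts

  AvoidsF-ren : ∀ {m n f} {ρ : Fin m → Fin n} → (∀ i → toℕ (ρ i) ≢ f) →
                (φ : Formula L m) → AvoidsF f (renF ρ φ)
  AvoidsF-ren avoid (s `= t)   = AvoidsT-ren avoid s , AvoidsT-ren avoid t
  AvoidsF-ren avoid (s `< t)   = AvoidsT-ren avoid s , AvoidsT-ren avoid t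
  AvoidsF-ren avoid (rel i ts) = AvoidsTs-ren avoid ts
  AvoidsF-ren avoid `⊥         = _
  AvoidsF-ren avoid (φ `∧ ψ)   = AvoidsF-ren avoid φ , AvoidsF-ren avoid ψ
  AvoidsF-ren avoid (φ `∨ ψ)   = AvoidsF-ren avoid φ , AvoidsF-ren avoid ψ
  AvoidsF-ren avoid (φ `⇒ ψ)   = AvoidsF-ren avoid φ , AvoidsF-ren avoid ψ
  AvoidsF-ren avoid (`∀ φ)     = AvoidsF-ren (liftRen-avoids avoid) φ
  AvoidsF-ren avoid (`∃ φ)     = AvoidsF-ren (liftRen-avoids avoid) φ

module _ {L : Lang} (M : Structure L) where

  private
    ≡⇒⇔ : ∀ {A B : Set} → A ≡ B → A ⇔ B
    ≡⇒⇔ refl = ⇔-id _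

    extend-agree : ∀ {m n} {ρ : Fin m → Fin n} {e : Fin n → Carrier M} {e' : Fin m → Carrier M} d →
                   (∀ i → e (ρ i) ≡ e' i) → ∀ i → extend d e (liftRen ρ i) ≡ extend d e' i
    extend-agree d agree fz     = refl
    extend-agree d agree (fs i) = agree i

    extend-agree-except : ∀ {n f} {e e' : Fin n → Carrier M} d → (∀ i → toℕ i ≢ f → e i ≡ e' i) →
                          ∀ i → toℕ i ≢ suc f → extend d e i ≡ extend d e' i
    extend-agree-except d agree fz     _   = refl
    extend-agree-except d agree (fs i) i≢f = agree i (i≢f ∘ cong suc)

    Π-⇔ : {P Q : Carrier M → Set} → (∀ d → P d ⇔ Q d) → ((d : Carrier M) → P d) ⇔ ((d : Carrier M) → Q d)
    Π-⇔ P⇔Q = mk⇔ (λ p d → Equivalence.to (P⇔Q d) (p d)) (λ q d → Equivalence.from (P⇔Q d) (q d))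

  evalT-ren : ∀ {m n} {ρ : Fin m → Fin n} {e e'} → (∀ i → e (ρ i) ≡ e' i) →
              ∀ t → evalT M e (renT ρ t) ≡ evalT M e' t
  evalT-ren agree (var i)   = agree i
  evalT-ren agree `0        = refl
  evalT-ren agree `1        = refl
  evalT-ren agree (s `+ t)  = cong₂ (addM M) (evalT-ren agree s) (evalT-ren agree t)
  evalT-ren agree (s `* t)  = cong₂ (mulM M) (evalT-ren agree s) (evalT-ren agree t)
  evalT-ren agree (const c) = refl

  evalTs-ren : ∀ {m n k} {ρ : Fin m → Fin n} {e e'} → (∀ i → e (ρ i) ≡ e' i) → (ts : Vec (Term L m) k) →
               evalTs M e (renTs ρ ts) ≡ evalTs M e' ts
  evalTs-ren agree []       = refl
  evalTs-ren agree (t ∷ ts) = cong₂ _∷_ (evalT-ren agree t) (evalTs-ren agree ts)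

  Sat-ren : ∀ {m n} {ρ : Fin m → Fin n} {e e'} → (∀ i → e (ρ i) ≡ e' i) →
            ∀ φ → Sat M (renF ρ φ) e ⇔ Sat M φ e'
  Sat-ren agree (s `= t)   = ≡⇒⇔ (cong₂ _≡_ (evalT-ren agree s) (evalT-ren agree t))
  Sat-ren agree (s `< t)   = ≡⇒⇔ (cong₂ (ltM M) (evalT-ren agree s) (evalT-ren agree t))
  Sat-ren agree (rel i ts) = ≡⇒⇔ (cong (relM M i) (evalTs-ren agree ts))
  Sat-ren agree `⊥         = ⇔-id _
  Sat-ren agree (φ `∧ ψ)   = Sat-ren agree φ ×-⇔ Sat-ren agree ψ
  Sat-ren agree (φ `∨ ψ)   = Sat-ren agree φ ⊎-⇔ Sat-ren agree ψ
  Sat-ren agree (φ `⇒ ψ)   = →-cong-⇔ (Sat-ren agree φ) (Sat-ren agree ψ)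
  Sat-ren agree (`∀ φ)     = Π-⇔ λ d → Sat-ren (extend-agree d agree) φ
  Sat-ren agree (`∃ φ)     = Σ-⇔ (↠-id _) (Sat-ren (extend-agree _ agree) φ)

  evalT-avoid : ∀ {n f} {e e' : Fin n → Carrier M} → (∀ i → toℕ i ≢ f → e i ≡ e' i) →
                ∀ t → AvoidsT f t → evalT M e t ≡ evalT M e' t
  evalT-avoid agree (var i)   i≢f       = agree i i≢f
  evalT-avoid agree `0        _         = refl
  evalT-avoid agree `1        _         = refl
  evalT-avoid agree (s `+ t)  (as , at) = cong₂ (addM M) (evalT-avoid agree s as) (evalT-avoid agree t at)
  evalT-avoid agree (s `* t)  (as , at) = cong₂ (mulM M) (evalT-avoid agree s as) (evalT-avoid agree t at)
  evalT-avoid agree (const c) _         = refl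

  evalTs-avoid : ∀ {n f k} {e e' : Fin n → Carrier M} → (∀ i → toℕ i ≢ f → e i ≡ e' i) →
                 (ts : Vec (Term L n) k) → AvoidsTs f ts → evalTs M e ts ≡ evalTs M e' ts
  evalTs-avoid agree []       _          = refl
  evalTs-avoid agree (t ∷ ts) (at , ats) = cong₂ _∷_ (evalT-avoid agree t at) (evalTs-avoid agree ts ats)

  Sat-avoid : ∀ {n f} {e e' : Fin n → Carrier M} → (∀ i → toℕ i ≢ f → e i ≡ e' i) →
              ∀ φ → AvoidsF f φ → Sat M φ e ⇔ Sat M φ e'
  Sat-avoid agree (s `= t)   (as , at) = ≡⇒⇔ (cong₂ _≡_ (evalT-avoid agree s as) (evalT-avoid agree t at))
  Sat-avoid agree (s `< t)   (as , at) = ≡⇒⇔ (cong₂ (ltM M) (evalT-avoid agree s as) (evalT-avoid agree t at))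
  Sat-avoid agree (rel i ts) ats       = ≡⇒⇔ (cong (relM M i) (evalTs-avoid agree ts ats))
  Sat-avoid agree `⊥         _         = ⇔-id _
  Sat-avoid agree (φ `∧ ψ)   (aφ , aψ) = Sat-avoid agree φ aφ ×-⇔ Sat-avoid agree ψ aψ
  Sat-avoid agree (φ `∨ ψ)   (aφ , aψ) = Sat-avoid agree φ aφ ⊎-⇔ Sat-avoid agree ψ aψ
  Sat-avoid agree (φ `⇒ ψ)   (aφ , aψ) = →-cong-⇔ (Sat-avoid agree φ aφ) (Sat-avoid agree ψ aψ)
  Sat-avoid agree (`∀ φ)     aφ        = Π-⇔ λ d → Sat-avoid (extend-agree-except d agree) φ aφ
  Sat-avoid agree (`∃ φ)     aφ        = Σ-⇔ (↠-id _) (Sat-avoid (extend-agree-except _ agree) φ aφ)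

module _ {L : Lang} (M : Structure L) (pa : ModelOfPA M) where

  private
    _⊕_ : Carrier M → Carrier M → Carrier M
    _⊕_ = addM M
    𝟙 = oneM M

    ⊕-identityˡ : ∀ x → zeroM M ⊕ x ≡ x
    ⊕-identityˡ = pa _ (ax-ind {n = 0} ((`0 `+ var fz) `= var fz))
      (pa _ ax-add0 (zeroM M) , λ d eq → trans (pa _ ax-addS (zeroM M) d) (cong (_⊕ 𝟙) eq))

    ⊕-sucˡ : ∀ a d → (a ⊕ 𝟙) ⊕ d ≡ (a ⊕ d) ⊕ 𝟙
    ⊕-sucˡ a = pa _ (ax-ind {n = 1} (((var (fs fz) `+ `1) `+ var fz) `= ((var (fs fz) `+ var fz) `+ `1))) a
      ( trans (pa _ ax-add0 (a ⊕ 𝟙)) (cong (_⊕ 𝟙) (sym (pa _ ax-add0 a)))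
      , λ d eq → trans (pa _ ax-addS (a ⊕ 𝟙) d)
                       (trans (cong (_⊕ 𝟙) eq) (cong (_⊕ 𝟙) (sym (pa _ ax-addS a d)))))

  numeral-injective : ∀ {m n} → numeral M m ≡ numeral M n → m ≡ n
  numeral-injective {zero}  {zero}  _  = refl
  numeral-injective {zero}  {suc n} eq = contradiction (sym eq) (pa _ ax-succ-ne0 _)
  numeral-injective {suc m} {zero}  eq = contradiction eq (pa _ ax-succ-ne0 _)
  numeral-injective {suc m} {suc n} eq = cong suc (numeral-injective (pa _ ax-succ-inj _ _ eq))

  numeral<nonstandard : ∀ {c} → (∀ n → c ≢ numeral M n) → ∀ n → ltM M (numeral M n) c
  numeral<nonstandard {c} nonstandard n = proj₂ (pa _ ax-lt (numeral M n) c) (gap n)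
    where
    gap : ∀ n → Σ (Carrier M) λ e → (numeral M n ⊕ e) ⊕ 𝟙 ≡ c
    difference : ∀ n → Σ (Carrier M) λ w → numeral M n ⊕ w ≡ c
    gap n with difference n
    ... | w , eq with pa _ ax-pred w
    ...   | inj₁ refl = contradiction (trans (sym eq) (pa _ ax-add0 (numeral M n))) (nonstandard n)
    ...   | inj₂ (e , refl) = e , trans (sym (pa _ ax-addS (numeral M n) e)) eq
    difference zero    = c , ⊕-identityˡ c
    difference (suc n) with gap n
    ... | e , eq = e , trans (⊕-sucˡ (numeral M n) e) eq

Eventually : (ℕ → Set) → Set
Eventually P = Σ ℕ λ B → ∀ n → B ≤ n → P n

eventually-All : ∀ {A : Set} {P : A → ℕ → Set} (xs : List A) →
                 All (λ x → Eventually (P x)) xs → Eventually (λ n → All (λ x → P x n) xs)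
eventually-All []       []                 = 0 , λ _ _ → []
eventually-All (x ∷ xs) ((B , Px) ∷ evs) with eventually-All xs evs
... | B' , Pxs = B ⊔ B' , λ n B⊔B'≤n →
  Px n (≤-trans (m≤m⊔n B B') B⊔B'≤n) ∷ Pxs n (≤-trans (m≤n⊔m B B') B⊔B'≤n)

-- In the formulas of the type, variable 0 is x, variable 1 is the nonstandard bound c
-- and the following ones are the parameters; in χ variable 0 is bound and x must not occur.
module UndefinableType (L : Lang) (m : ℕ) where
  open Parser L (2 + m)

  bound : Formula L (2 + m)
  bound = var fz `< var (fs fz)

  isX : Formula L (3 + m)
  isX = var fz `= var (fs fz)

  definedBy notDefinedBy : Formula L (3 + m) → Formula L (2 + m)
  definedBy χ = `∃ (χ `∧ isX) `∧ `∀ (χ `⇒ isX)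
  notDefinedBy χ = `¬ (definedBy χ)

  UndefinableType : FormulaSet L (suc m)
  UndefinableType φ = φ ≡ bound ⊎ Σ (Formula L (3 + m)) λ χ → AvoidsF 1 χ × φ ≡ notDefinedBy χ

  undefinableType-bounded : BoundedType UndefinableType
  undefinableType-bounded = fz , inj₁ refl

  notDefinedByCode : ℕ → ℕ
  notDefinedByCode X =
    ⟪ 6 , ⟪ ⟪ 4 , ⟪ ⟪ 8 , ⟪ 4 , ⟪ X , codeᵒF isX ⟫ ⟫ ⟫ , ⟪ 7 , ⟪ 6 , ⟪ X , codeᵒF isX ⟫ ⟫ ⟫ ⟫ ⟫
          , ⟪ 3 , 0 ⟫ ⟫ ⟫

  definingFormula : ℕ → ℕ
  definingFormula = unpair₁ ∘ unpair₂ ∘ unpair₂ ∘ unpair₁ ∘ unpair₂ ∘ unpair₁ ∘ unpair₂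

  codeF-notDefinedBy : ∀ χ → codeF (notDefinedBy χ) ≡ notDefinedByCode (codeF χ)
  codeF-notDefinedBy χ = begin
    codeF (notDefinedBy χ)      ≡⟨ codeᵒF≡codeF (notDefinedBy χ) ⟨
    codeᵒF (notDefinedBy χ)     ≡⟨⟩
    notDefinedByCode (codeᵒF χ) ≡⟨ cong notDefinedByCode (codeᵒF≡codeF χ) ⟩
    notDefinedByCode (codeF χ)  ∎
    where open ≡-Reasoning

  definingFormula-notDefinedByCode : ∀ X → definingFormula (notDefinedByCode X) ≡ X
  definingFormula-notDefinedByCode X = begin
    definingFormula (notDefinedByCode X)
      ≡⟨ cong (unpair₁ ∘ unpair₂ ∘ unpair₂ ∘ unpair₁ ∘ unpair₂ ∘ unpair₁) (unpair₂-⟪⟫ 6 _) ⟩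
    (unpair₁ ∘ unpair₂ ∘ unpair₂ ∘ unpair₁ ∘ unpair₂ ∘ unpair₁) ⟪ ⟪ 4 , ⟪ existsCode , uniqueCode ⟫ ⟫ , ⟪ 3 , 0 ⟫ ⟫
      ≡⟨ cong (unpair₁ ∘ unpair₂ ∘ unpair₂ ∘ unpair₁ ∘ unpair₂) (unpair₁-⟪⟫ _ _) ⟩
    (unpair₁ ∘ unpair₂ ∘ unpair₂ ∘ unpair₁ ∘ unpair₂) ⟪ 4 , ⟪ existsCode , uniqueCode ⟫ ⟫
      ≡⟨ cong (unpair₁ ∘ unpair₂ ∘ unpair₂ ∘ unpair₁) (unpair₂-⟪⟫ 4 _) ⟩
    (unpair₁ ∘ unpair₂ ∘ unpair₂ ∘ unpair₁) ⟪ existsCode , uniqueCode ⟫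
      ≡⟨ cong (unpair₁ ∘ unpair₂ ∘ unpair₂) (unpair₁-⟪⟫ _ _) ⟩
    (unpair₁ ∘ unpair₂ ∘ unpair₂) ⟪ 8 , ⟪ 4 , ⟪ X , codeᵒF isX ⟫ ⟫ ⟫
      ≡⟨ cong (unpair₁ ∘ unpair₂) (unpair₂-⟪⟫ 8 _) ⟩
    (unpair₁ ∘ unpair₂) ⟪ 4 , ⟪ X , codeᵒF isX ⟫ ⟫
      ≡⟨ cong unpair₁ (unpair₂-⟪⟫ 4 _) ⟩
    unpair₁ ⟪ X , codeᵒF isX ⟫
      ≡⟨ unpair₁-⟪⟫ X _ ⟩
    X ∎
    where
    open ≡-Reasoning
    existsCode uniqueCode : ℕ
    existsCode = ⟪ 8 , ⟪ 4 , ⟪ X , codeᵒF isX ⟫ ⟫ ⟫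
    uniqueCode = ⟪ 7 , ⟪ 6 , ⟪ X , codeᵒF isX ⟫ ⟫ ⟫

  notDefinedByℕ : ℕ → ℕ
  notDefinedByℕ k = eqℕ k (notDefinedByCode (definingFormula k)) + avoidingFormulaℕ 1 (definingFormula k)

  memberℕ : ℕ → ℕ
  memberℕ k = eqℕ k (codeF bound) * notDefinedByℕ k

  memberℕ-computable : Computable₁ memberℕ
  memberℕ-computable = computable-by
    (*-computable · ( eqᵉ k (lit (codeF bound))
                    ∷ +-computable · (eqᵉ k (notDefinedByCodeᵉ X) ∷ avoidingᵉ ∷ []) ∷ []))
    λ { (k ∷ []) → refl }
    where
    k X avoidingᵉ : Expr 1
    k = arg (# 0)
    X = unpair₁ᵉ (unpair₂ᵉ (unpair₂ᵉ (unpair₁ᵉ (unpair₂ᵉ (unpair₁ᵉ (unpair₂ᵉ k))))))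
    avoidingᵉ = avoidingFormulaℕ-computable · (lit 1 ∷ X ∷ [])
    notDefinedByCodeᵉ : Expr 1 → Expr 1
    notDefinedByCodeᵉ X =
      ⟪ lit 6 , ⟪ ⟪ lit 4 , ⟪ ⟪ lit 8 , ⟪ lit 4 , ⟪ X , lit (codeᵒF isX) ⟫ᵉ ⟫ᵉ ⟫ᵉ
                          , ⟪ lit 7 , ⟪ lit 6 , ⟪ X , lit (codeᵒF isX) ⟫ᵉ ⟫ᵉ ⟫ᵉ ⟫ᵉ ⟫ᵉ
                , ⟪ lit 3 , lit 0 ⟫ᵉ ⟫ᵉ ⟫ᵉ

  Member : ℕ → Set
  Member k = Σ (Formula L (2 + m)) λ φ → UndefinableType φ × codeF φ ≡ k

  notDefinedBy-member : ∀ {k X} → k ≡ notDefinedByCode X → Valid (formula , 1 , X) → Member k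
  notDefinedBy-member {k} {X} k≡ (χ , aχ , cχ) = notDefinedBy χ , inj₂ (χ , aχ , refl) , (begin
    codeF (notDefinedBy χ)     ≡⟨ codeF-notDefinedBy χ ⟩
    notDefinedByCode (codeF χ) ≡⟨ cong notDefinedByCode cχ ⟩
    notDefinedByCode X         ≡⟨ k≡ ⟨
    k                          ∎)
    where open ≡-Reasoning

  notDefinedByℕ-sound : ∀ k → notDefinedByℕ k ≡ 0 → Member k
  notDefinedByℕ-sound k accepted =
    notDefinedBy-member (eqℕ≡0⇒≡ (m+n≡0⇒m≡0 same accepted))
                        (avoidingFormulaℕ-sound 1 (definingFormula k) (m+n≡0⇒n≡0 same accepted))
    where
    same : ℕ
    same = eqℕ k (notDefinedByCode (definingFormula k))

  notDefinedByℕ-complete : ∀ {k} χ → AvoidsF 1 χ → k ≡ notDefinedByCode (codeF χ) → notDefinedByℕ k ≡ 0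
  notDefinedByℕ-complete {k} χ aχ k≡ = begin
    eqℕ k (notDefinedByCode (definingFormula k)) + avoidingFormulaℕ 1 (definingFormula k)
      ≡⟨ cong (λ X → eqℕ k (notDefinedByCode X) + avoidingFormulaℕ 1 X) defining-χ ⟩
    eqℕ k (notDefinedByCode (codeF χ)) + avoidingFormulaℕ 1 (codeF χ)
      ≡⟨ cong₂ _+_ (≡⇒eqℕ≡0 k≡) (avoidingFormulaℕ-complete 1 (codeF χ) (χ , aχ , refl)) ⟩
    0 ∎
    where
    open ≡-Reasoning
    defining-χ : definingFormula k ≡ codeF χ
    defining-χ = trans (cong definingFormula k≡) (definingFormula-notDefinedByCode (codeF χ))

  memberℕ-sound : ∀ k → memberℕ k ≡ 0 → Member k
  memberℕ-sound k accepted with m*n≡0⇒m≡0∨n≡0 (eqℕ k (codeF bound)) accepted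
  ... | inj₁ is-bound        = bound , inj₁ refl , sym (eqℕ≡0⇒≡ is-bound)
  ... | inj₂ is-notDefinedBy = notDefinedByℕ-sound k is-notDefinedBy

  memberℕ-complete : ∀ k → Member k → memberℕ k ≡ 0
  memberℕ-complete k (_ , inj₁ refl , eq)            = cong (_* notDefinedByℕ k) (≡⇒eqℕ≡0 (sym eq))
  memberℕ-complete k (_ , inj₂ (χ , aχ , refl) , eq) =
    trans (cong (eqℕ k (codeF bound) *_) (notDefinedByℕ-complete χ aχ (trans (sym eq) (codeF-notDefinedBy χ))))
          (*-zeroʳ (eqℕ k (codeF bound)))

  undefinableType-recursive : RecursiveType UndefinableType
  undefinableType-recursive = recursive-by-zeros memberℕ-computable memberℕ-sound memberℕ-complete

module _ {L : Lang} (M : Structure L) {m : ℕ} (params : Fin (suc m) → Carrier M) where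
  open UndefinableType L m

  Defines : Formula L (3 + m) → Carrier M → Set
  Defines χ x = Sat M (definedBy χ) (extend x params)

  defines-unique : ∀ χ {x y} → AvoidsF 1 χ → Defines χ x → Defines χ y → y ≡ x
  defines-unique χ {x} {y} aχ (_ , only-x) ((d , χ[d,y] , d≡y) , _) =
    trans (sym d≡y) (only-x d (Equivalence.to (Sat-avoid M agree χ aχ) χ[d,y]))
    where
    agree : ∀ i → toℕ i ≢ 1 → extend d (extend y params) i ≡ extend d (extend x params) i
    agree fz            _   = refl
    agree (fs fz)       i≢1 = contradiction refl i≢1
    agree (fs (fs i))   _   = refl

module _ (em : ExcludedMiddle 0ℓ) {L : Lang} (M : Structure L) (pa : ModelOfPA M)
         {m : ℕ} (ā : Fin m → Carrier M) {c : Carrier M} (c-nonstandard : ∀ n → c ≢ numeral M n) where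
  open UndefinableType L m

  -- χ defines at most one element, so at most one numeral fails; excluded middle decides
  -- whether one does.
  eventually-notDefinedBy : ∀ χ → AvoidsF 1 χ →
                            Eventually λ n → Sat M (notDefinedBy χ) (extend (numeral M n) (extend c ā))
  eventually-notDefinedBy χ aχ with em {Σ ℕ λ n → Defines M (extend c ā) χ (numeral M n)}
  ... | yes (n₀ , defines-n₀) = suc n₀ , λ n n₀<n defines-n →
          <-irrefl (numeral-injective M pa (defines-unique M (extend c ā) χ aχ defines-n defines-n₀)) n₀<n
  ... | no none = 0 , λ n _ defines-n → none (n , defines-n)

  undefinableType-finitelySatisfiable : FinitelySatisfiable M UndefinableType (extend c ā)
  undefinableType-finitelySatisfiable φs φs∈type with eventually-All φs (All.map eventually φs∈type)
    where
    eventually : ∀ {φ} → UndefinableType φ → Eventually λ n → Sat M φ (extend (numeral M n) (extend c ā))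
    eventually (inj₁ refl)            = 0 , λ n _ → numeral<nonstandard M pa c-nonstandard n
    eventually (inj₂ (χ , aχ , refl)) = eventually-notDefinedBy χ aχ
  ... | B , realized = numeral M B , realized B ≤-refl

module _ {L : Lang} (M : Structure L) {m : ℕ} (ā : Fin m → Carrier M) (c : Carrier M) where
  open UndefinableType L m

  undefinableType-unrealized : (∀ b → DefinableFrom M ā b) → ¬ Realized M UndefinableType (extend c ā)
  undefinableType-unrealized definable (b , realizes) with definable b
  ... | ψ , ψ[b] , only-b = realizes (notDefinedBy χ) (inj₂ (χ , AvoidsF-ren skip-avoids ψ , refl)) defines-b
    where
    skip : Fin (suc m) → Fin (3 + m)
    skip fz     = fz
    skip (fs i) = fs (fs (fs i))
    skip-avoids : ∀ i → toℕ (skip i) ≢ 1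
    skip-avoids fz     ()
    skip-avoids (fs i) ()
    χ : Formula L (3 + m)
    χ = renF skip ψ
    χ⇔ψ : ∀ d → Sat M χ (extend d (extend b (extend c ā))) ⇔ Sat M ψ (extend d ā)
    χ⇔ψ d = Sat-ren M agree ψ
      where
      agree : ∀ i → extend d (extend b (extend c ā)) (skip i) ≡ extend d ā i
      agree fz     = refl
      agree (fs i) = refl
    defines-b : Defines M (extend c ā) χ b
    defines-b = (b , Equivalence.from (χ⇔ψ b) ψ[b] , refl) , λ d χ[d] → only-b d (Equivalence.to (χ⇔ψ d) χ[d])

proposition4p13 : ExcludedMiddle 0ℓ → (L : Lang) (M : Structure L) →
    ModelOfPA M → Nonstandard M → ShortRecursivelySaturated M →
    ¬ FinitelyGenerated M
proposition4p13 em L M pa (c , c-nonstandard) saturated (m , ā , definable) =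
  undefinableType-unrealized M ā c definable
    (saturated (suc m) (extend c ā) UndefinableType undefinableType-recursive undefinableType-bounded
               (undefinableType-finitelySatisfiable em M pa ā c-nonstandard))
  where open UndefinableType L m
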